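{- Fix positive integers $n$ and $k$. The set $\{\hat{s}_\nu : \nu\vdash n,\ \mathrm{rank}(\nu)=k,\ \ell(\nu)=k\}$ is a basis of the $\mathbb{Q}$-vector space $\mathrm{span}_{\mathbb{Q}}\{\hat{s}_\lambda : \lambda\vdash n,\ \mathrm{rank}(\lambda)=k\}$.
   Context: For a partition $\lambda$, $\ell(\lambda)$ is its number of nonzero parts and $\mathrm{rank}(\lambda)$ (Frobenius rank) is the largest $i$ with $\lambda_i\ge i$. $p_\nu=p_{\nu_1}p_{\nu_2}\cdots$ are power sum symmetric functions, $z_\nu=\prod_i i^{m_i(\nu)}m_i(\nu)!$ where $m_i(\nu)$ is the number of parts of $\nu$ equal to $i$, and $\chi^\lambda(\nu)$ is the value of the irreducible character of $S_n$ indexed by $\lambda\vdash n$ on permutations of cycle type $\nu$. The bottom Schur function is $\hat{s}_\lambda=\sum_{\nu\vdash n,\ \ell(\nu)=\mathrm{rank}(\lambda)}\chi^\lambda(\nu)\,p_\nu/z_\nu$, i.e. the lowest-degree part of $s_\lambda=\sum_\nu\chi^\lambda(\nu)p_\nu/z_\nu$ when each $p_i$ is given degree $1$. -}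

module Defs where

open import Data.Bool using (Bool; true; false; if_then_else_; _∧_; _∨_; not)
open import Data.Nat as ℕ using (ℕ; zero; suc; _+_; _*_; _∸_; _≤_; _≥_; _⊔_; _≤ᵇ_; _≡ᵇ_; _<ᵇ_)
import Data.Nat.Properties as ℕP
open import Data.Nat.ListAction using (sum; product)
open import Data.Integer as ℤ using (ℤ; +_; -[1+_])
open import Data.Rational as ℚ using (ℚ; 0ℚ)
open import Data.List using (List; []; _∷_; length; map; applyUpTo; zipWith; foldr; filter)
open import Data.List.Relation.Unary.All using (All; all?)
open import Data.List.Relation.Unary.Linked using (Linked; linked?)
open import Data.List.Relation.Unary.Unique.Propositional using (Unique)
open import Data.Product using (_×_; _,_; ∃)
open import Relation.Nullary using (Dec; does; _×-dec_)
open import Relation.Binary.PropositionalEquality using (_≡_)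

_⊢_ : List ℕ → ℕ → Set
λ′ ⊢ n = (sum λ′ ≡ n) × All (1 ≤_) λ′ × Linked _≥_ λ′

_⊢?_ : (λ′ : List ℕ) (n : ℕ) → Dec (λ′ ⊢ n)
λ′ ⊢? n = (sum λ′ ℕ.≟ n) ×-dec (all? (1 ℕ.≤?_) λ′ ×-dec linked? (λ a b → b ℕ.≤? a) λ′)

ℓ : List ℕ → ℕ
ℓ = length

-- Frobenius rank: the largest i (1-indexed) with λ_i ≥ i (0 if none).
rankFrom : ℕ → List ℕ → ℕ
rankFrom i []       = 0
rankFrom i (x ∷ xs) = (if i ≤ᵇ x then i else 0) ⊔ rankFrom (suc i) xs

rank : List ℕ → ℕ
rank = rankFrom 1

mult : ℕ → List ℕ → ℕ
mult i ν = length (filter (λ j → j ℕ.≟ i) ν)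

z : List ℕ → ℕ
z ν = product (applyUpTo (λ j → let i = suc j in (i ℕ.^ mult i ν) * (mult i ν) ℕ.!) (sum ν))

-- Irreducible characters χ^λ(ν) of S_n, computed by the
-- Murnaghan–Nakayama rule on beta-sets (first-column hook lengths).

-- beta-set of λ with ℓ(λ) = L:  β_i = λ_i + L - i  (strictly decreasing)
betaFrom : ℕ → List ℕ → List ℕ
betaFrom L []       = []
betaFrom L (x ∷ xs) = (x + (L ∸ 1)) ∷ betaFrom (L ∸ 1) xs

beta : List ℕ → List ℕ
beta λ′ = betaFrom (length λ′) λ′

memb : ℕ → List ℕ → Bool
memb a []       = false
memb a (x ∷ xs) = (a ≡ᵇ x) ∨ memb a xs

insertDesc : ℕ → List ℕ → List ℕ
insertDesc a []       = a ∷ []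
insertDesc a (x ∷ xs) = if x <ᵇ a then a ∷ x ∷ xs else x ∷ insertDesc a xs

remove : ℕ → List ℕ → List ℕ
remove a []       = []
remove a (x ∷ xs) = if a ≡ᵇ x then xs else x ∷ remove a xs

between : ℕ → ℕ → List ℕ → ℕ
between lo hi β = length (filter (λ c → (lo ℕ.<? c) ×-dec (c ℕ.<? hi)) β)

sgn : ℕ → ℤ
sgn zero          = + 1
sgn (suc zero)    = -[1+ 0 ]
sgn (suc (suc k)) = sgn k

sumℤ : List ℤ → ℤ
sumℤ = foldr ℤ._+_ (+ 0)

-- the beta-set of the empty partition with L beads: L-1, ..., 1, 0
emptyBeta : ℕ → List ℕ
emptyBeta zero    = []
emptyBeta (suc L) = L ∷ emptyBeta L

eqList : List ℕ → List ℕ → Bool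
eqList []       []       = true
eqList (x ∷ xs) (y ∷ ys) = (x ≡ᵇ y) ∧ eqList xs ys
eqList _        _        = false

-- Murnaghan–Nakayama: removing a rim hook of length r ↔ moving a bead
-- b ∈ β to the free position b - r, with sign (-1)^(#beads strictly between).
mn : List ℕ → List ℕ → ℤ
mn β []       = if eqList β (emptyBeta (length β)) then + 1 else + 0
mn β (r ∷ rs) = sumℤ (map term β)
  where
  term : ℕ → ℤ
  term b = if (r ≤ᵇ b) ∧ not (memb (b ∸ r) β)
           then sgn (between (b ∸ r) b β) ℤ.* mn (insertDesc (b ∸ r) (remove b β)) rs
           else + 0

χ : List ℕ → List ℕ → ℤ
χ λ′ ν = mn (beta λ′) ν

-- Symmetric functions of degree n over ℚ, written in the power-sum basis:
-- a function giving the coefficient of p_ν for each ν (zero unless ν is a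
-- partition).

SymFn : Set
SymFn = List ℕ → ℚ

divℕ : ℤ → ℕ → ℚ
divℕ a zero    = 0ℚ
divℕ a (suc m) = a ℚ./ suc m

sHat : List ℕ → SymFn
sHat λ′ ν = if does (ν ⊢? sum λ′) ∧ (length ν ≡ᵇ rank λ′)
            then divℕ (χ λ′ ν) (z ν)
            else 0ℚ

sumℚ : List ℚ → ℚ
sumℚ = foldr ℚ._+_ 0ℚ

lincomb : List ℚ → List SymFn → SymFn
lincomb cs fs ν = sumℚ (zipWith (λ c f → c ℚ.* f ν) cs fs)

LinIndepHat : (List ℕ → Set) → Set
LinIndepHat P = (νs : List (List ℕ)) (cs : List ℚ) → Unique νs → All P νs →
  length cs ≡ length νs → (∀ μ → lincomb cs (map sHat νs) μ ≡ 0ℚ) →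
  All (_≡ 0ℚ) cs

InSpanHat : (List ℕ → Set) → SymFn → Set
InSpanHat P f = ∃ λ (p : List (List ℕ) × List ℚ) → let (νs , cs) = p in
  All P νs × length cs ≡ length νs × (∀ μ → lincomb cs (map sHat νs) μ ≡ f μ)

{-# OPTIONS --safe #-}
-- Write a partition λ of Frobenius rank k as (A | B), with arms A and legs B strictly decreasing
-- of length k, and let
--   pairings A B (r ∷ μ) = Σᵢⱼ (-1)^(i+j) [aᵢ + bⱼ + 1 = r] · pairings (A without aᵢ) (B without bⱼ) μ.
-- The beta-set of λ has exactly k beads at positions ≥ ℓ(λ), and a Murnaghan–Nakayama step lowers
-- their number by at most one. For ℓ(μ) = k every step must therefore move such a bead below ℓ(λ),
-- i.e. strip a whole hook of length aᵢ + bⱼ + 1, whence χ^λ(μ) = (-1)^|B| · pairings A B μ.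
-- The ν with ℓ(ν) = rank ν = k are exactly those whose legs are the staircase δ = emptyBeta k = (k-1, …, 0).
-- Spanning: writing bumps r X for the lists obtained by adding 1 to r entries of X, the identity
--   Σ_{A′ ∈ bumps r A} pairings A′ B = Σ_{B′ ∈ bumps r B} pairings A B′
-- expresses pairings A B through terms whose legs are lighter, down to legs δ.
-- Independence: at the hook lengths μ of (A | δ), pairings A′ δ μ is 1 for A′ = A and 0 for A′
-- lexicographically smaller than A, so the ŝ_ν are unitriangular against these evaluations.

module Submission where

open import Defs
open import Data.Bool using (Bool; true; false; T; if_then_else_; _∧_; _∨_; not)
open import Data.Empty using (⊥-elim)
open import Data.Product using (Σ; ∃; _×_; _,_; proj₁; proj₂)
open import Data.Sum using (_⊎_; inj₁; inj₂)
open import Data.Nat as ℕ using (ℕ; zero; suc; _≤_; _<_; _≥_; _>_; z≤n; s≤s; _≡ᵇ_; _<ᵇ_; _≤ᵇ_)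
import Data.Nat.Properties as ℕP
open import Data.Integer as ℤ using (ℤ; 0ℤ; 1ℤ)
import Data.Integer.Properties as ℤP
open import Data.Rational as ℚ using (ℚ; 0ℚ)
import Data.Rational.Properties as ℚP
open import Data.List using (List; []; _∷_; length; map; _++_; filter)
import Data.List.Properties as ListP
open import Data.Nat.ListAction using (sum)
open import Data.List.Relation.Unary.All as All using (All; []; _∷_)
import Data.List.Relation.Unary.All.Properties as AllP
open import Data.List.Relation.Unary.AllPairs as AllPairs using (AllPairs; []; _∷_)
import Data.List.Relation.Unary.AllPairs.Properties as AllPairsP
open import Data.List.Relation.Unary.Any using (here; there)
open import Data.List.Membership.Propositional using (_∈_)
open import Data.List.Membership.DecPropositional ℕP._≟_ using (_∈?_)
open import Relation.Nullary using (¬_; yes; no; does; Dec)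
open import Relation.Nullary.Decidable using (dec-true; dec-false)
open import Relation.Binary.PropositionalEquality

Decreasing : List ℕ → Set
Decreasing = AllPairs _>_

does⇒ : ∀ {P : Set} (P? : Dec P) → does P? ≡ true → P
does⇒ (yes p) _ = p

does⇒¬ : ∀ {P : Set} (P? : Dec P) → does P? ≡ false → ¬ P
does⇒¬ (no ¬p) _ = ¬p

does-cong : ∀ {P Q : Set} (P? : Dec P) (Q? : Dec Q) → (P → Q) → (Q → P) → does P? ≡ does Q?
does-cong (yes _) (yes _) _   _   = refl
does-cong (no _)  (no _)  _   _   = refl
does-cong (yes p) (no ¬q) P→Q _   = ⊥-elim (¬q (P→Q p))
does-cong (no ¬p) (yes q) _   Q→P = ⊥-elim (¬p (Q→P q))

module IntegerSums where

  open import Data.Integer using (_+_; _-_; _*_; -_)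
  open import Data.Integer.Tactic.RingSolver using (solve-∀)

  ∑ : {A : Set} → List A → (A → ℤ) → ℤ
  ∑ xs f = sumℤ (map f xs)

  module _ {A : Set} where

    ∑-++ : ∀ xs ys (f : A → ℤ) → ∑ (xs ++ ys) f ≡ ∑ xs f + ∑ ys f
    ∑-++ []       ys f = sym (ℤP.+-identityˡ _)
    ∑-++ (x ∷ xs) ys f = trans (cong (f x +_) (∑-++ xs ys f)) (sym (ℤP.+-assoc (f x) _ _))

    ∑-map : ∀ {B : Set} (g : B → A) xs (f : A → ℤ) → ∑ (map g xs) f ≡ ∑ xs (λ x → f (g x))
    ∑-map g xs f = cong sumℤ (sym (ListP.map-∘ xs))

    ∑-cong : ∀ {f g : A → ℤ} xs → (∀ {x} → x ∈ xs → f x ≡ g x) → ∑ xs f ≡ ∑ xs g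
    ∑-cong []       f≗g = refl
    ∑-cong (x ∷ xs) f≗g = cong₂ _+_ (f≗g (here refl)) (∑-cong xs (λ x∈xs → f≗g (there x∈xs)))

    ∑-zero : ∀ {f : A → ℤ} xs → (∀ {x} → x ∈ xs → f x ≡ 0ℤ) → ∑ xs f ≡ 0ℤ
    ∑-zero []       f≗0 = refl
    ∑-zero (x ∷ xs) f≗0 = cong₂ _+_ (f≗0 (here refl)) (∑-zero xs (λ x∈xs → f≗0 (there x∈xs)))

    ∑-+ : ∀ (f g : A → ℤ) xs → ∑ xs (λ x → f x + g x) ≡ ∑ xs f + ∑ xs g
    ∑-+ f g []       = refl
    ∑-+ f g (x ∷ xs) = trans (cong (_+_ (f x + g x)) (∑-+ f g xs)) (interchange (f x) (g x) _ _)
      where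
      interchange : ∀ a b c d → (a + b) + (c + d) ≡ (a + c) + (b + d)
      interchange = solve-∀

    ∑-neg : ∀ (f : A → ℤ) xs → ∑ xs (λ x → - f x) ≡ - ∑ xs f
    ∑-neg f []       = refl
    ∑-neg f (x ∷ xs) = trans (cong (_+_ (- f x)) (∑-neg f xs)) (sym (ℤP.neg-distrib-+ (f x) _))

    ∑-- : ∀ (f g : A → ℤ) xs → ∑ xs (λ x → f x - g x) ≡ ∑ xs f - ∑ xs g
    ∑-- f g xs = trans (∑-+ f (λ x → - g x) xs) (cong (_+_ (∑ xs f)) (∑-neg g xs))

    ∑-* : ∀ c (f : A → ℤ) xs → ∑ xs (λ x → c * f x) ≡ c * ∑ xs f
    ∑-* c f []       = sym (ℤP.*-zeroʳ c)
    ∑-* c f (x ∷ xs) = trans (cong (_+_ (c * f x)) (∑-* c f xs)) (sym (ℤP.*-distribˡ-+ c (f x) _))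

open IntegerSums

module SignedPairings where

  open import Data.Integer using (_+_; _-_)
  open import Data.Integer.Tactic.RingSolver using (solve-∀)
  open import Algebra.Properties.CommutativeSemigroup ℕP.+-commutativeSemigroup using (x∙yz≈y∙xz)

  -- altSum f (x₀ ∷ … ∷ xₙ) = Σᵢ (-1)ⁱ f xᵢ (the list with its i-th entry deleted)
  altSum : (ℕ → List ℕ → ℤ) → List ℕ → ℤ
  altSum f []       = 0ℤ
  altSum f (x ∷ xs) = f x xs - altSum (λ y ys → f y (x ∷ ys)) xs

  altSum-cong : ∀ {f g} xs → (∀ y ys → f y ys ≡ g y ys) → altSum f xs ≡ altSum g xs
  altSum-cong []       f≗g = refl
  altSum-cong (x ∷ xs) f≗g = cong₂ _-_ (f≗g x xs) (altSum-cong xs (λ y ys → f≗g y (x ∷ ys)))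

  altSum-zero : ∀ {f} xs → (∀ y ys → f y ys ≡ 0ℤ) → altSum f xs ≡ 0ℤ
  altSum-zero []       f≗0 = refl
  altSum-zero (x ∷ xs) f≗0 = cong₂ _-_ (f≗0 x xs) (altSum-zero xs (λ y ys → f≗0 y (x ∷ ys)))

  altSum-+ : ∀ f g xs → altSum (λ y ys → f y ys + g y ys) xs ≡ altSum f xs + altSum g xs
  altSum-+ f g []       = refl
  altSum-+ f g (x ∷ xs) = trans
    (cong (f x xs + g x xs -_) (altSum-+ (λ y ys → f y (x ∷ ys)) (λ y ys → g y (x ∷ ys)) xs))
    (interchange (f x xs) (g x xs) _ _)
    where
    interchange : ∀ a b c d → (a + b) - (c + d) ≡ (a - c) + (b - d)
    interchange = solve-∀

  altSum-- : ∀ f g xs → altSum (λ y ys → f y ys - g y ys) xs ≡ altSum f xs - altSum g xs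
  altSum-- f g []       = refl
  altSum-- f g (x ∷ xs) = trans
    (cong (f x xs - g x xs -_) (altSum-- (λ y ys → f y (x ∷ ys)) (λ y ys → g y (x ∷ ys)) xs))
    (interchange (f x xs) (g x xs) _ _)
    where
    interchange : ∀ a b c d → (a - b) - (c - d) ≡ (a - c) - (b - d)
    interchange = solve-∀

  altSum-swap : ∀ (F : ℕ → List ℕ → ℕ → List ℕ → ℤ) A B →
    altSum (λ a A′ → altSum (λ b B′ → F a A′ b B′) B) A ≡ altSum (λ b B′ → altSum (λ a A′ → F a A′ b B′) A) B
  altSum-swap F []       B = sym (altSum-zero B (λ _ _ → refl))
  altSum-swap F (x ∷ xs) B = begin
      altSum (F x xs) B - altSum (λ a A′ → altSum (λ b B′ → F a (x ∷ A′) b B′) B) xs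
    ≡⟨ cong (altSum (F x xs) B -_) (altSum-swap (λ a A′ → F a (x ∷ A′)) xs B) ⟩
      altSum (F x xs) B - altSum (λ b B′ → altSum (λ a A′ → F a (x ∷ A′) b B′) xs) B
    ≡⟨ altSum-- (F x xs) _ B ⟨
      altSum (λ b B′ → F x xs b B′ - altSum (λ a A′ → F a (x ∷ A′) b B′) xs) B
    ∎
    where open ≡-Reasoning

  when : Bool → ℤ → ℤ
  when b v = if b then v else 0ℤ

  when-zero : ∀ b {v} → v ≡ 0ℤ → when b v ≡ 0ℤ
  when-zero false _   = refl
  when-zero true  v≡0 = v≡0

  when-≢ : ∀ m n v → m ≢ n → when (m ≡ᵇ n) v ≡ 0ℤ
  when-≢ m n v m≢n rewrite dec-false (m ℕ.≟ n) m≢n = refl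

  when-refl : ∀ m v → when (m ≡ᵇ m) v ≡ v
  when-refl m v rewrite dec-true (m ℕ.≟ m) refl = refl

  altSum-vanishes : ∀ {Q : ℕ → Set} {f} xs → All Q xs → (∀ y ys → Q y → f y ys ≡ 0ℤ) → altSum f xs ≡ 0ℤ
  altSum-vanishes []       _          _   = refl
  altSum-vanishes (x ∷ xs) (qx ∷ qxs) f≗0 =
    cong₂ _-_ (f≗0 x xs qx) (altSum-vanishes xs qxs (λ y ys → f≗0 y (x ∷ ys)))

  altSum-vanishes-sum : ∀ {f} xs → (∀ y ys → sum xs ≡ y ℕ.+ sum ys → f y ys ≡ 0ℤ) → altSum f xs ≡ 0ℤ
  altSum-vanishes-sum []       _   = refl
  altSum-vanishes-sum (x ∷ xs) f≗0 = cong₂ _-_ (f≗0 x xs refl)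
    (altSum-vanishes-sum xs (λ y ys sum≡ → f≗0 y (x ∷ ys) (trans (cong (x ℕ.+_) sum≡) (x∙yz≈y∙xz x y (sum ys)))))

  pairings : List ℕ → List ℕ → List ℕ → ℤ
  pairings A       B       (r ∷ μ) =
    altSum (λ a A′ → altSum (λ b B′ → when (suc (a ℕ.+ b) ≡ᵇ r) (pairings A′ B′ μ)) B) A
  pairings []      []      []      = 1ℤ
  pairings []      (_ ∷ _) []      = 0ℤ
  pairings (_ ∷ _) _       []      = 0ℤ

  pairings-comm : ∀ A B μ → pairings A B μ ≡ pairings B A μ
  pairings-comm A       B       (r ∷ μ) = trans (altSum-swap _ A B)
    (altSum-cong B (λ b B′ → altSum-cong A (λ a A′ →
      cong₂ when (cong (λ t → suc t ≡ᵇ r) (ℕP.+-comm a b)) (pairings-comm A′ B′ μ))))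
  pairings-comm []      []      [] = refl
  pairings-comm []      (_ ∷ _) [] = refl
  pairings-comm (_ ∷ _) []      [] = refl
  pairings-comm (_ ∷ _) (_ ∷ _) [] = refl

  data AdjacentRepeat : List ℕ → Set where
    here  : ∀ {x xs} → AdjacentRepeat (x ∷ x ∷ xs)
    there : ∀ {x xs} → AdjacentRepeat xs → AdjacentRepeat (x ∷ xs)

  altSum-adjacentRepeat : ∀ {f} xs → (∀ y ys → AdjacentRepeat ys → f y ys ≡ 0ℤ) →
    AdjacentRepeat xs → altSum f xs ≡ 0ℤ
  -- deleting either copy of x leaves the same list, so the first two terms cancel
  altSum-adjacentRepeat {f} (x ∷ x ∷ xs) f≗0 here = begin
      f x (x ∷ xs) - (f x (x ∷ xs) - altSum _ xs)
    ≡⟨ cong (λ t → f x (x ∷ xs) - (f x (x ∷ xs) - t)) (altSum-zero xs (λ y ys → f≗0 y (x ∷ x ∷ ys) here)) ⟩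
      f x (x ∷ xs) - (f x (x ∷ xs) - 0ℤ)
    ≡⟨ cancel (f x (x ∷ xs)) ⟩
      0ℤ
    ∎
    where
    open ≡-Reasoning
    cancel : ∀ a → a - (a - 0ℤ) ≡ 0ℤ
    cancel = solve-∀
  altSum-adjacentRepeat (x ∷ xs) f≗0 (there rep) =
    cong₂ _-_ (f≗0 x xs rep) (altSum-adjacentRepeat xs (λ y ys rep′ → f≗0 y (x ∷ ys) (there rep′)) rep)

  pairings-adjacentRepeatˡ : ∀ A B μ → AdjacentRepeat A → pairings A B μ ≡ 0ℤ
  pairings-adjacentRepeatˡ A       B (r ∷ μ) rep = altSum-adjacentRepeat A
    (λ a A′ rep′ → altSum-zero B (λ b B′ → when-zero _ (pairings-adjacentRepeatˡ A′ B′ μ rep′))) rep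
  pairings-adjacentRepeatˡ (_ ∷ _) B []      rep = refl

  pairings-adjacentRepeatʳ : ∀ A B μ → AdjacentRepeat B → pairings A B μ ≡ 0ℤ
  pairings-adjacentRepeatʳ A B μ rep = trans (pairings-comm A B μ) (pairings-adjacentRepeatˡ B A μ rep)

open SignedPairings

module Bumps where

  open import Data.Integer using (_+_; _-_)
  open import Data.Integer.Tactic.RingSolver using (solve-∀)

  bumps : ℕ → List ℕ → List (List ℕ)
  bumps zero    xs       = xs ∷ []
  bumps (suc r) []       = []
  bumps (suc r) (x ∷ xs) = map (suc x ∷_) (bumps r xs) ++ map (x ∷_) (bumps (suc r) xs)

  bumps-length : ∀ r xs → All (λ X → length X ≡ length xs) (bumps r xs)
  bumps-length zero    xs       = refl ∷ []
  bumps-length (suc r) []       = []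
  bumps-length (suc r) (x ∷ xs) = AllP.++⁺ (AllP.map⁺ (All.map (cong suc) (bumps-length r xs)))
                                           (AllP.map⁺ (All.map (cong suc) (bumps-length (suc r) xs)))

  ∑-bumps-suc : ∀ (h : List ℕ → ℤ) r x xs → ∑ (bumps (suc r) (x ∷ xs)) h ≡
    ∑ (bumps r xs) (λ X → h (suc x ∷ X)) + ∑ (bumps (suc r) xs) (λ X → h (x ∷ X))
  ∑-bumps-suc h r x xs = trans (∑-++ (map (suc x ∷_) (bumps r xs)) _ h)
    (cong₂ _+_ (∑-map (suc x ∷_) (bumps r xs) h) (∑-map (x ∷_) (bumps (suc r) xs) h))

  ∑-bumps-nonempty : ∀ r x xs (h : List ℕ → ℤ) → (∀ y ys → h (y ∷ ys) ≡ 0ℤ) → ∑ (bumps r (x ∷ xs)) h ≡ 0ℤ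
  ∑-bumps-nonempty r x xs h h≗0 =
    ∑-zero (bumps r (x ∷ xs)) (λ X∈ → vanish (All.lookup (bumps-length r (x ∷ xs)) X∈))
    where
    vanish : ∀ {X} → length X ≡ suc (length xs) → h X ≡ 0ℤ
    vanish {y ∷ ys} _ = h≗0 y ys

  module _ {A : Set} where

    ∑-altSum : ∀ (F : A → ℕ → List ℕ → ℤ) xs Xs →
      ∑ Xs (λ X → altSum (F X) xs) ≡ altSum (λ y ys → ∑ Xs (λ X → F X y ys)) xs
    ∑-altSum F xs []       = sym (altSum-zero xs (λ _ _ → refl))
    ∑-altSum F xs (X ∷ Xs) = trans (cong (_+_ (altSum (F X) xs)) (∑-altSum F xs Xs))
      (sym (altSum-+ (F X) (λ y ys → ∑ Xs (λ X′ → F X′ y ys)) xs))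

    ∑-when : ∀ b (h : A → ℤ) Xs → ∑ Xs (λ X → when b (h X)) ≡ when b (∑ Xs h)
    ∑-when true  h Xs = refl
    ∑-when false h Xs = ∑-zero Xs (λ _ → refl)

  -- the part of ∑ (bumps r (a ∷ Ar)) (λ X → F (head X) (tail X)) in which a is bumped
  headBumped : ℕ → (ℕ → List ℕ → ℤ) → ℕ → List ℕ → ℤ
  headBumped zero    F a Ar = 0ℤ
  headBumped (suc r) F a Ar = ∑ (bumps r Ar) (F (suc a))

  headBumped-∷ : ∀ r (F : ℕ → List ℕ → ℤ) x a Ar → headBumped (suc r) F a (x ∷ Ar) ≡
    headBumped r (λ y ys → F y (suc x ∷ ys)) a Ar + headBumped (suc r) (λ y ys → F y (x ∷ ys)) a Ar
  headBumped-∷ zero    F x a Ar = sym (ℤP.+-identityˡ _)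
  headBumped-∷ (suc r) F x a Ar = ∑-bumps-suc (F (suc a)) r x Ar

  ∑-bumps-altSum : ∀ r F A →
    ∑ (bumps r A) (altSum F) ≡ altSum (λ a Ar → headBumped r F a Ar + ∑ (bumps r Ar) (F a)) A
  ∑-bumps-altSum zero    F A        = trans (ℤP.+-identityʳ _)
    (altSum-cong A (λ a Ar → sym (trans (ℤP.+-identityˡ _) (ℤP.+-identityʳ _))))
  ∑-bumps-altSum (suc r) F []       = refl
  ∑-bumps-altSum (suc r) F (x ∷ xs) = begin
      ∑ (bumps (suc r) (x ∷ xs)) (altSum F)
    ≡⟨ ∑-bumps-suc (altSum F) r x xs ⟩
      ∑ (bumps r xs) (λ X → F (suc x) X - altSum F₁ X) + ∑ (bumps (suc r) xs) (λ X → F x X - altSum F₀ X)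
    ≡⟨ cong₂ _+_ (∑-- (F (suc x)) (altSum F₁) (bumps r xs)) (∑-- (F x) (altSum F₀) (bumps (suc r) xs)) ⟩
      (P₁ - Q₁) + (P₀ - Q₀)
    ≡⟨ interchange P₁ Q₁ P₀ Q₀ ⟩
      (P₁ + P₀) - (Q₁ + Q₀)
    ≡⟨ cong ((P₁ + P₀) -_) (cong₂ _+_ (∑-bumps-altSum r F₁ xs) (∑-bumps-altSum (suc r) F₀ xs)) ⟩
      (P₁ + P₀) - (altSum H₁ xs + altSum H₀ xs)
    ≡⟨ cong ((P₁ + P₀) -_) (altSum-+ H₁ H₀ xs) ⟨
      (P₁ + P₀) - altSum (λ a Ar → H₁ a Ar + H₀ a Ar) xs
    ≡⟨ cong ((P₁ + P₀) -_) (altSum-cong xs regroup) ⟩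
      (P₁ + P₀) - altSum (λ a Ar → H a (x ∷ Ar)) xs
    ∎
    where
    open ≡-Reasoning
    F₁ F₀ H₁ H₀ H : ℕ → List ℕ → ℤ
    F₁ y ys = F y (suc x ∷ ys)
    F₀ y ys = F y (x ∷ ys)
    H₁ a Ar = headBumped r F₁ a Ar + ∑ (bumps r Ar) (F₁ a)
    H₀ a Ar = headBumped (suc r) F₀ a Ar + ∑ (bumps (suc r) Ar) (F₀ a)
    H  a Ar = headBumped (suc r) F a Ar + ∑ (bumps (suc r) Ar) (F a)
    P₁ P₀ Q₁ Q₀ : ℤ
    P₁ = ∑ (bumps r xs) (F (suc x))
    P₀ = ∑ (bumps (suc r) xs) (F x)
    Q₁ = ∑ (bumps r xs) (altSum F₁)
    Q₀ = ∑ (bumps (suc r) xs) (altSum F₀)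
    interchange : ∀ a b c d → (a - b) + (c - d) ≡ (a + c) - (b + d)
    interchange = solve-∀
    interchange′ : ∀ a b c d → (a + b) + (c + d) ≡ (a + c) + (b + d)
    interchange′ = solve-∀
    regroup : ∀ a Ar → H₁ a Ar + H₀ a Ar ≡ H a (x ∷ Ar)
    regroup a Ar = sym (trans (cong₂ _+_ (headBumped-∷ r F x a Ar) (∑-bumps-suc (F a) r x Ar))
                              (interchange′ (headBumped r F₁ a Ar) (headBumped (suc r) F₀ a Ar) _ _))

  bump-transfer : ∀ μ r A B →
    ∑ (bumps r A) (λ A′ → pairings A′ B μ) ≡ ∑ (bumps r B) (λ B′ → pairings A B′ μ)
  bump-transfer []      r       (x ∷ xs) B        =
    trans (∑-bumps-nonempty r x xs _ (λ _ _ → refl)) (sym (∑-zero (bumps r B) (λ _ → refl)))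
  bump-transfer []      zero    []       B        = refl
  bump-transfer []      (suc r) []       []       = refl
  bump-transfer []      (suc r) []       (y ∷ ys) = sym (∑-bumps-nonempty (suc r) y ys _ (λ _ _ → refl))
  bump-transfer (s ∷ μ) r       A        B        = begin
      ∑ (bumps r A) (altSum F)
    ≡⟨ ∑-bumps-altSum r F A ⟩
      altSum (λ a Ar → headBumped r F a Ar + ∑ (bumps r Ar) (F a)) A
    ≡⟨ altSum-cong A (λ a Ar → trans (cong₂ _+_ (bumped r a Ar) (unbumped r a Ar)) (sym (altSum-+ _ _ B))) ⟩
      altSum (λ a Ar → altSum (λ b Br → headBumped r (Fa a Ar) b Br + ∑ (bumps r Br) (Fa a Ar b)) B) A
    ≡⟨ altSum-cong A (λ a Ar → ∑-bumps-altSum r (Fa a Ar) B) ⟨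
      altSum (λ a Ar → ∑ (bumps r B) (altSum (Fa a Ar))) A
    ≡⟨ ∑-altSum (λ B′ a Ar → altSum (Fa a Ar) B′) A (bumps r B) ⟨
      ∑ (bumps r B) (λ B′ → altSum (λ a Ar → altSum (Fa a Ar) B′) A)
    ∎
    where
    open ≡-Reasoning
    hit : ℕ → ℕ → Bool
    hit a b = suc (a ℕ.+ b) ≡ᵇ s
    F : ℕ → List ℕ → ℤ
    F a A′ = altSum (λ b B′ → when (hit a b) (pairings A′ B′ μ)) B
    Fa : ℕ → List ℕ → ℕ → List ℕ → ℤ
    Fa a Ar b B′ = when (hit a b) (pairings Ar B′ μ)
    unbumped : ∀ r a Ar → ∑ (bumps r Ar) (F a) ≡ altSum (λ b Br → ∑ (bumps r Br) (Fa a Ar b)) B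
    unbumped r a Ar = trans (∑-altSum (λ X b B′ → when (hit a b) (pairings X B′ μ)) B (bumps r Ar))
      (altSum-cong B (λ b Br → trans (∑-when (hit a b) _ (bumps r Ar))
        (trans (cong (when (hit a b)) (bump-transfer μ r Ar Br)) (sym (∑-when (hit a b) _ (bumps r Br))))))
    bumped : ∀ r a Ar → headBumped r F a Ar ≡ altSum (λ b Br → headBumped r (Fa a Ar) b Br) B
    bumped zero    a Ar = sym (altSum-zero B (λ _ _ → refl))
    bumped (suc r) a Ar = trans (unbumped r (suc a) Ar) (altSum-cong B (λ b Br → ∑-cong (bumps r Br)
      (λ {Y} _ → cong (λ t → when (suc t ≡ᵇ s) (pairings Ar Y μ)) (sym (ℕP.+-suc a b)))))

open Bumps

module Staircase where

  open import Data.List using (downFrom)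
  open import Data.List.Membership.Propositional.Properties using (∈-downFrom⁺; ∈-downFrom⁻)

  staircase≡downFrom : ∀ L → emptyBeta L ≡ downFrom L
  staircase≡downFrom zero    = refl
  staircase≡downFrom (suc L) = cong (L ∷_) (staircase≡downFrom L)

  length-staircase : ∀ L → length (emptyBeta L) ≡ L
  length-staircase L = trans (cong length (staircase≡downFrom L)) (ListP.length-downFrom L)

  ∈-staircase⁺ : ∀ {x L} → x < L → x ∈ emptyBeta L
  ∈-staircase⁺ {L = L} x<L = subst (_ ∈_) (sym (staircase≡downFrom L)) (∈-downFrom⁺ x<L)

  ∈-staircase⁻ : ∀ {x L} → x ∈ emptyBeta L → x < L
  ∈-staircase⁻ {L = L} x∈ = ∈-downFrom⁻ (subst (_ ∈_) (staircase≡downFrom L) x∈)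

  staircase-< : ∀ L → All (_< L) (emptyBeta L)
  staircase-< L = All.tabulate ∈-staircase⁻

  staircase-decreasing : ∀ L → Decreasing (emptyBeta L)
  staircase-decreasing zero    = []
  staircase-decreasing (suc L) = staircase-< L ∷ staircase-decreasing L

  length-decreasing-< : ∀ {B L} → Decreasing B → All (_< L) B → length B ≤ L
  length-decreasing-< {[]}    _          _         = z≤n
  length-decreasing-< {b ∷ B} (b>B ∷ B↓) (b<L ∷ _) = ℕP.≤-trans (s≤s (length-decreasing-< B↓ b>B)) b<L

  decreasing-full⇒staircase : ∀ {B L} → Decreasing B → All (_< L) B → length B ≡ L → B ≡ emptyBeta L
  decreasing-full⇒staircase {[]}    {zero}  _          _           _   = refl
  decreasing-full⇒staircase {b ∷ B} {suc L} (b>B ∷ B↓) (b<1+L ∷ _) eq with b ℕ.≟ L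
  ... | yes refl = cong (b ∷_) (decreasing-full⇒staircase B↓ b>B (ℕP.suc-injective eq))
  ... | no  b≢L  = ⊥-elim (ℕP.<-irrefl refl (ℕP.<-≤-trans (ℕP.≤∧≢⇒< (ℕP.≤-pred b<1+L) b≢L)
                     (subst (_≤ b) (ℕP.suc-injective eq) (length-decreasing-< B↓ b>B))))

open Staircase

module StaircaseSpan where

  open import Data.Nat using (_+_; _*_; _^_)
  open import Data.Nat.Tactic.RingSolver using (solve-∀)
  open import Data.Integer using (-_) renaming (_+_ to _+ℤ_; _-_ to _-ℤ_; _*_ to _*ℤ_)
  import Data.Integer.Tactic.RingSolver as ℤ-Solver
  open import Induction.WellFounded using (Acc; acc)
  open import Data.Nat.Induction using (<-wellFounded)

  NonIncreasing : List ℕ → Set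
  NonIncreasing = AllPairs _≥_

  nonIncreasing⇒decreasing⊎repeat : ∀ {xs} → NonIncreasing xs → Decreasing xs ⊎ AdjacentRepeat xs
  nonIncreasing⇒decreasing⊎repeat [] = inj₁ []
  nonIncreasing⇒decreasing⊎repeat (_ ∷ xs↓) with nonIncreasing⇒decreasing⊎repeat xs↓
  ... | inj₂ rep = inj₂ (there rep)
  nonIncreasing⇒decreasing⊎repeat {x ∷ []}     _                 | inj₁ [] = inj₁ ([] ∷ [])
  nonIncreasing⇒decreasing⊎repeat {x ∷ y ∷ ys} ((y≤x ∷ _) ∷ _) | inj₁ (y>ys ∷ ys↓) with y ℕ.≟ x
  ... | yes refl = inj₂ here
  ... | no  y≢x  = inj₁ ((y<x ∷ All.map (λ z<y → ℕP.<-trans z<y y<x) y>ys) ∷ y>ys ∷ ys↓)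
    where y<x = ℕP.≤∧≢⇒< y≤x y≢x

  bumps-≤ : ∀ {x} r xs → All (_< x) xs → All (All (_≤ x)) (bumps r xs)
  bumps-≤ zero    xs       xs<x         = All.map ℕP.<⇒≤ xs<x ∷ []
  bumps-≤ (suc r) []       _            = []
  bumps-≤ (suc r) (y ∷ ys) (y<x ∷ ys<x) =
    AllP.++⁺ (AllP.map⁺ (All.map (y<x ∷_) (bumps-≤ r ys ys<x)))
             (AllP.map⁺ (All.map (ℕP.<⇒≤ y<x ∷_) (bumps-≤ (suc r) ys ys<x)))

  bumps-nonIncreasing : ∀ r {xs} → Decreasing xs → All NonIncreasing (bumps r xs)
  bumps-nonIncreasing zero    xs↓ = AllPairs.map ℕP.<⇒≤ xs↓ ∷ []
  bumps-nonIncreasing (suc r) []  = []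
  bumps-nonIncreasing (suc r) {x ∷ xs} (x>xs ∷ xs↓) = AllP.++⁺
    (AllP.map⁺ (All.zipWith (λ (≤x , X↓) → All.map ℕP.m≤n⇒m≤1+n ≤x ∷ X↓)
                            (bumps-≤ r xs x>xs , bumps-nonIncreasing r xs↓)))
    (AllP.map⁺ (All.zipWith (λ (≤x , X↓) → ≤x ∷ X↓)
                            (bumps-≤ (suc r) xs x>xs , bumps-nonIncreasing (suc r) xs↓)))

  -- binary weights: bumping an entry outweighs bumping any set of later entries
  weight : List ℕ → ℕ
  weight []       = 0
  weight (x ∷ xs) = x * 2 ^ length xs + weight xs

  bumpPrefix : ℕ → List ℕ → List ℕ
  bumpPrefix zero    xs       = xs
  bumpPrefix (suc r) []       = []
  bumpPrefix (suc r) (x ∷ xs) = suc x ∷ bumpPrefix r xs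

  length-bumpPrefix : ∀ r xs → length (bumpPrefix r xs) ≡ length xs
  length-bumpPrefix zero    xs       = refl
  length-bumpPrefix (suc r) []       = refl
  length-bumpPrefix (suc r) (x ∷ xs) = cong suc (length-bumpPrefix r xs)

  weight-bumpPrefix-≤ : ∀ r xs → weight xs ≤ weight (bumpPrefix r xs)
  weight-bumpPrefix-≤ zero    xs       = ℕP.≤-refl
  weight-bumpPrefix-≤ (suc r) []       = ℕP.≤-refl
  weight-bumpPrefix-≤ (suc r) (x ∷ xs) rewrite length-bumpPrefix r xs =
    ℕP.+-mono-≤ (ℕP.*-monoˡ-≤ (2 ^ length xs) (ℕP.n≤1+n x)) (weight-bumpPrefix-≤ r xs)

  weight-bumpPrefix-< : ∀ r xs → 1 ≤ r → r ≤ length xs → weight xs < weight (bumpPrefix r xs)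
  weight-bumpPrefix-< (suc r) (x ∷ xs) _ _ rewrite length-bumpPrefix r xs =
    ℕP.+-mono-<-≤ (ℕP.+-monoˡ-≤ (x * 2 ^ length xs) (ℕP.m^n>0 2 (length xs))) (weight-bumpPrefix-≤ r xs)

  bumps-weight-< : ∀ r xs → All (λ X → weight X < weight xs + 2 ^ length xs) (bumps r xs)
  bumps-weight-< zero    xs       = ℕP.m<m+n (weight xs) (ℕP.m^n>0 2 (length xs)) ∷ []
  bumps-weight-< (suc r) []       = []
  bumps-weight-< (suc r) (y ∷ ys) = AllP.++⁺
    (AllP.map⁺ (All.zipWith (λ {X} (len , w<) → bumped X len w<) (bumps-length r ys , bumps-weight-< r ys)))
    (AllP.map⁺ (All.zipWith (λ {X} (len , w<) → kept X len w<)
                            (bumps-length (suc r) ys , bumps-weight-< (suc r) ys)))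
    where
    P = 2 ^ length ys
    bumped : ∀ X → length X ≡ length ys → weight X < weight ys + P → weight (suc y ∷ X) < weight (y ∷ ys) + 2 * P
    bumped X len w< rewrite len = ℕP.<-≤-trans (ℕP.+-monoʳ-< (P + y * P) w<)
      (ℕP.≤-reflexive (regroup y P (weight ys)))
      where
      regroup : ∀ y P w → P + y * P + (w + P) ≡ y * P + w + 2 * P
      regroup = solve-∀
    kept : ∀ X → length X ≡ length ys → weight X < weight ys + P → weight (y ∷ X) < weight (y ∷ ys) + 2 * P
    kept X len w< rewrite len = ℕP.<-≤-trans (ℕP.+-monoʳ-< (y * P) w<)
      (ℕP.≤-trans (ℕP.m≤m+n _ P) (ℕP.≤-reflexive (regroup y P (weight ys))))
      where
      regroup : ∀ y P w → y * P + (w + P) + P ≡ y * P + w + 2 * P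
      regroup = solve-∀

  bumps-head : ∀ r d → r ≤ length d → Σ (List (List ℕ)) λ rest →
    bumps r d ≡ bumpPrefix r d ∷ rest × All (λ X → weight X < weight (bumpPrefix r d)) rest
  bumps-head zero    d        _       = [] , refl , []
  bumps-head (suc r) (x ∷ xs) (s≤s h) with bumps-head r xs h | bumps-length r xs
  ... | rest , bumps≡ , rest< | lengths rewrite bumps≡ =
    map (suc x ∷_) rest ++ map (x ∷_) (bumps (suc r) xs) , refl ,
    AllP.++⁺ (AllP.map⁺ (All.zipWith (λ {X} (len , w<) → bumped X len w<) (All.tail lengths , rest<)))
             (AllP.map⁺ (All.zipWith (λ {X} (len , w<) → kept X len w<)
                                     (bumps-length (suc r) xs , bumps-weight-< (suc r) xs)))
    where
    P = 2 ^ length xs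
    bumped : ∀ X → length X ≡ length xs → weight X < weight (bumpPrefix r xs) →
             weight (suc x ∷ X) < weight (bumpPrefix (suc r) (x ∷ xs))
    bumped X len w< rewrite len | length-bumpPrefix r xs = ℕP.+-monoʳ-< (suc x * P) w<
    kept : ∀ X → length X ≡ length xs → weight X < weight xs + P →
           weight (x ∷ X) < weight (bumpPrefix (suc r) (x ∷ xs))
    kept X len w< rewrite len | length-bumpPrefix r xs = ℕP.<-≤-trans (ℕP.+-monoʳ-< (x * P) w<)
      (ℕP.≤-trans (ℕP.≤-reflexive (regroup x P (weight xs))) (ℕP.+-monoʳ-≤ (P + x * P) (weight-bumpPrefix-≤ r xs)))
      where
      regroup : ∀ x P w → x * P + (w + P) ≡ P + x * P + w
      regroup = solve-∀

  data StaircaseView : List ℕ → Set where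
    staircase : ∀ L → StaircaseView (emptyBeta L)
    bumped    : ∀ {r d} → 1 ≤ r → r ≤ length d → Decreasing d → StaircaseView (bumpPrefix r d)

  staircase-∷ : ∀ x L → All (x >_) (emptyBeta L) → StaircaseView (x ∷ emptyBeta L)
  staircase-∷ x L x>δ with x ℕ.≟ L
  ... | yes refl = staircase (suc L)
  staircase-∷ zero    zero    _   | no 0≢0 = ⊥-elim (0≢0 refl)
  staircase-∷ zero    (suc L) (() ∷ _) | no _
  staircase-∷ (suc x) zero    _   | no _   = bumped (s≤s z≤n) (s≤s z≤n) ([] ∷ [])
  staircase-∷ (suc x) (suc L) x>δ | no x≢L =
    bumped (s≤s z≤n) (s≤s z≤n) (All.map (λ y<L → ℕP.<-≤-trans y<L L≤x) (staircase-< (suc L)) ∷ staircase-decreasing (suc L))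
    where
    L≤x : suc L ≤ x
    L≤x = ℕP.≤-pred (ℕP.≤∧≢⇒< (All.head x>δ) (λ L≡x → x≢L (sym L≡x)))

  bumped-∷ : ∀ {x r d} → All (x >_) (bumpPrefix r d) → 1 ≤ r → r ≤ length d → Decreasing d →
    StaircaseView (x ∷ bumpPrefix r d)
  bumped-∷ {suc x} {suc r} {d₀ ∷ ds} (1+d₀<1+x ∷ _) _ (s≤s r≤) (d₀>ds ∷ ds↓) =
    bumped (s≤s z≤n) (s≤s (s≤s r≤)) ((d₀<x ∷ All.map (λ y<d₀ → ℕP.<-trans y<d₀ d₀<x) d₀>ds) ∷ d₀>ds ∷ ds↓)
    where d₀<x = ℕP.≤-pred 1+d₀<1+x

  staircaseView : ∀ {B} → Decreasing B → StaircaseView B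
  staircaseView []           = staircase 0
  staircaseView (x>xs ∷ xs↓) with staircaseView xs↓
  ... | staircase L           = staircase-∷ _ L x>xs
  ... | bumped 1≤r r≤d d↓     = bumped-∷ x>xs 1≤r r≤d d↓

  Arms : ℕ → List ℕ → Set
  Arms k A = Decreasing A × length A ≡ k

  combination : ℕ → List (ℤ × List ℕ) → List ℕ → ℤ
  combination k cs μ = ∑ cs (λ (q , C) → q *ℤ pairings C (emptyBeta k) μ)

  Span : ℕ → (List ℕ → ℤ) → Set
  Span k f = Σ (List (ℤ × List ℕ)) λ cs → All (λ (_ , C) → Arms k C) cs × (∀ μ → f μ ≡ combination k cs μ)

  span-zero : ∀ {k f} → (∀ μ → f μ ≡ 0ℤ) → Span k f
  span-zero f≗0 = [] , [] , f≗0

  span-cong : ∀ {k f g} → (∀ μ → f μ ≡ g μ) → Span k g → Span k f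
  span-cong f≗g (cs , arms , g≗) = cs , arms , λ μ → trans (f≗g μ) (g≗ μ)

  span-+ : ∀ {k f g} → Span k f → Span k g → Span k (λ μ → f μ +ℤ g μ)
  span-+ {k} (cs , arms , f≗) (ds , arms′ , g≗) = cs ++ ds , AllP.++⁺ arms arms′ ,
    λ μ → trans (cong₂ _+ℤ_ (f≗ μ) (g≗ μ)) (sym (∑-++ cs ds _))

  span-neg : ∀ {k f} → Span k f → Span k (λ μ → - f μ)
  span-neg {k} (cs , arms , f≗) = map (λ (q , C) → - q , C) cs , AllP.map⁺ arms ,
    λ μ → trans (cong -_ (f≗ μ)) (sym (trans (∑-map _ cs _)
      (trans (∑-cong cs (λ {(q , C)} _ → sym (ℤP.neg-distribˡ-* q (pairings C (emptyBeta k) μ))))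
             (∑-neg _ cs))))

  span-∑ : ∀ {k} {A : Set} (h : A → List ℕ → ℤ) Xs → All (λ X → Span k (h X)) Xs →
    Span k (λ μ → ∑ Xs (λ X → h X μ))
  span-∑ h []       []         = span-zero (λ μ → refl)
  span-∑ h (X ∷ Xs) (sp ∷ sps) = span-+ sp (span-∑ h Xs sps)

  pairings-span-acc : ∀ {k} B → Acc _<_ (weight B) → ∀ {A} → Arms k A → Arms k B → Span k (pairings A B)
  pairings-span-acc B (acc rec) {A} armsA (B↓ , lenB) with staircaseView B↓
  ... | staircase L = (1ℤ , A) ∷ [] , armsA ∷ [] , λ μ →
    trans (cong (λ L → pairings A (emptyBeta L) μ) (trans (sym (length-staircase L)) lenB))
          (sym (trans (ℤP.+-identityʳ _) (ℤP.*-identityˡ _)))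
  ... | bumped {r} {d} 1≤r r≤d d↓ with bumps-head r d r≤d
  ... | rest , bumps≡ , rest< = span-cong transfer (span-+ viaArms (span-neg viaLegs))
    where
    lenA = proj₂ armsA
    lend : length d ≡ _
    lend = trans (sym (length-bumpPrefix r d)) lenB
    transfer : ∀ μ → pairings A (bumpPrefix r d) μ ≡
      ∑ (bumps r A) (λ A′ → pairings A′ d μ) +ℤ - ∑ rest (λ B′ → pairings A B′ μ)
    transfer μ = trans (sym (cancel _ _)) (cong (_-ℤ ∑ rest (λ B′ → pairings A B′ μ))
      (sym (trans (bump-transfer μ r A d) (cong (∑-list μ) bumps≡))))
      where
      ∑-list : List ℕ → List (List ℕ) → ℤ
      ∑-list μ Bs = ∑ Bs (λ B′ → pairings A B′ μ)
      cancel : ∀ x s → (x +ℤ s) -ℤ s ≡ x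
      cancel = ℤ-Solver.solve-∀
    viaArms : Span _ (λ μ → ∑ (bumps r A) (λ A′ → pairings A′ d μ))
    viaArms = span-∑ (λ A′ μ → pairings A′ d μ) (bumps r A)
      (All.zipWith arm (bumps-nonIncreasing r (proj₁ armsA) , bumps-length r A))
      where
      arm : ∀ {A′} → NonIncreasing A′ × length A′ ≡ length A → Span _ (λ μ → pairings A′ d μ)
      arm (A′↓ , lenA′) with nonIncreasing⇒decreasing⊎repeat A′↓
      ... | inj₁ A′↓′ = pairings-span-acc d (rec (weight-bumpPrefix-< r d 1≤r r≤d)) (A′↓′ , trans lenA′ lenA) (d↓ , lend)
      ... | inj₂ rep  = span-zero (λ μ → pairings-adjacentRepeatˡ _ d μ rep)
    viaLegs : Span _ (λ μ → ∑ rest (λ B′ → pairings A B′ μ))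
    viaLegs = span-∑ (λ B′ μ → pairings A B′ μ) rest (All.zipWith leg (restShape , rest<))
      where
      restShape : All (λ X → NonIncreasing X × length X ≡ length d) rest
      restShape = All.tail (subst (All (λ X → NonIncreasing X × length X ≡ length d)) bumps≡
                    (All.zip (bumps-nonIncreasing r d↓ , bumps-length r d)))
      leg : ∀ {B′} → (NonIncreasing B′ × length B′ ≡ length d) × weight B′ < weight (bumpPrefix r d) →
            Span _ (pairings A B′)
      leg ((B′↓ , lenB′) , w<) with nonIncreasing⇒decreasing⊎repeat B′↓
      ... | inj₁ B′↓′ = pairings-span-acc _ (rec w<) armsA (B′↓′ , trans lenB′ lend)
      ... | inj₂ rep  = span-zero (λ μ → pairings-adjacentRepeatʳ A _ μ rep)

  pairings-span : ∀ {k A B} → Arms k A → Arms k B → Span k (pairings A B)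
  pairings-span {B = B} = pairings-span-acc B (<-wellFounded (weight B))

open StaircaseSpan

module Triangularity where

  open import Data.Nat using (_+_)
  open import Data.Nat.Tactic.RingSolver using (solve-∀)
  open import Data.Integer using () renaming (_-_ to _-ℤ_)
  open import Data.List.Relation.Binary.Lex.Strict using (Lex-<; this; next)

  pairings-sizeMismatch : ∀ μ C D → sum μ ≢ sum C + sum D + length μ → pairings C D μ ≡ 0ℤ
  pairings-sizeMismatch []      []      []      size≢ = ⊥-elim (size≢ refl)
  pairings-sizeMismatch []      []      (_ ∷ _) _     = refl
  pairings-sizeMismatch []      (_ ∷ _) _       _     = refl
  pairings-sizeMismatch (r ∷ μ) C       D       size≢ =
    altSum-vanishes-sum C (λ a A′ sumC → altSum-vanishes-sum D (λ b B′ sumD → term a A′ b B′ sumC sumD))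
    where
    term : ∀ a A′ b B′ → sum C ≡ a + sum A′ → sum D ≡ b + sum B′ →
           when (suc (a + b) ≡ᵇ r) (pairings A′ B′ μ) ≡ 0ℤ
    term a A′ b B′ sumC sumD with suc (a + b) ℕ.≟ r
    ... | no  ≢r   = when-≢ _ _ (pairings A′ B′ μ) ≢r
    ... | yes refl = trans (when-refl (suc (a + b)) (pairings A′ B′ μ)) (pairings-sizeMismatch μ A′ B′ (λ sum≡ → size≢ (begin
        suc (a + b) + sum μ
      ≡⟨ cong (suc (a + b) +_) sum≡ ⟩
        suc (a + b) + (sum A′ + sum B′ + length μ)
      ≡⟨ regroup a b (sum A′) (sum B′) (length μ) ⟩
        (a + sum A′) + (b + sum B′) + suc (length μ)
      ≡⟨ cong₂ (λ u v → u + v + suc (length μ)) sumC sumD ⟨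
        sum C + sum D + suc (length μ)
      ∎)))
      where
      open ≡-Reasoning
      regroup : ∀ a b x y l → suc (a + b) + (x + y + l) ≡ (a + x) + (b + y) + suc l
      regroup = solve-∀

  -- the hook lengths of the partition with arms A and legs the staircase
  diagonalHooks : List ℕ → List ℕ
  diagonalHooks []       = []
  diagonalHooks (a ∷ as) = suc (a + length as) ∷ diagonalHooks as

  _<ₗₑₓ_ : List ℕ → List ℕ → Set
  _<ₗₑₓ_ = Lex-< _≡_ _<_

  pairings-hook-head : ∀ a as m μ → Decreasing (a ∷ as) →
    pairings (a ∷ as) (emptyBeta (suc m)) (suc (a + m) ∷ μ) ≡ pairings as (emptyBeta m) μ
  pairings-hook-head a as m μ (a>as ∷ _) =
    trans (cong₂ _-ℤ_ pickA pickOther) (ℤP.+-identityʳ (pairings as (emptyBeta m) μ))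
    where
    r = suc (a + m)
    f : ℕ → List ℕ → ℤ
    f y ys = altSum (λ b B′ → when (suc (y + b) ≡ᵇ r) (pairings ys B′ μ)) (m ∷ emptyBeta m)
    pickA : f a as ≡ pairings as (emptyBeta m) μ
    pickA = trans (cong₂ _-ℤ_ (when-refl r (pairings as (emptyBeta m) μ))
      (altSum-vanishes (emptyBeta m) (staircase-< m) (λ b B′ b<m →
        when-≢ (suc (a + b)) r (pairings as (m ∷ B′) μ) (λ eq → ℕP.<-irrefl eq (s≤s (ℕP.+-monoʳ-< a b<m))))))
      (ℤP.+-identityʳ (pairings as (emptyBeta m) μ))
    pickOther : altSum (λ y ys → f y (a ∷ ys)) as ≡ 0ℤ
    pickOther = altSum-vanishes as a>as (λ y ys y<a →
      altSum-vanishes (m ∷ emptyBeta m) (ℕP.≤-refl ∷ All.map ℕP.<⇒≤ (staircase-< m)) (λ b B′ b≤m →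
        when-≢ (suc (y + b)) r (pairings (a ∷ ys) B′ μ) (λ eq → ℕP.<-irrefl eq (s≤s (ℕP.+-mono-<-≤ y<a b≤m)))))

  pairings-hook-tooLong : ∀ a as m r μ → Decreasing (a ∷ as) → suc (a + m) < r →
    pairings (a ∷ as) (emptyBeta (suc m)) (r ∷ μ) ≡ 0ℤ
  pairings-hook-tooLong a as m r μ (a>as ∷ _) hook<r =
    altSum-vanishes (a ∷ as) (ℕP.≤-refl ∷ All.map ℕP.<⇒≤ a>as) (λ y ys y≤a →
      altSum-vanishes (m ∷ emptyBeta m) (ℕP.≤-refl ∷ All.map ℕP.<⇒≤ (staircase-< m)) (λ b B′ b≤m →
        when-≢ (suc (y + b)) r (pairings ys B′ μ) (λ eq → ℕP.<-irrefl eq (ℕP.≤-<-trans (s≤s (ℕP.+-mono-≤ y≤a b≤m)) hook<r))))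

  pairings-diagonalHooks-lex< : ∀ A′ A → Decreasing A′ → length A′ ≡ length A → A′ <ₗₑₓ A →
    pairings A′ (emptyBeta (length A)) (diagonalHooks A) ≡ 0ℤ
  pairings-diagonalHooks-lex< (a′ ∷ as′) (a ∷ as) A′↓ _ (this a′<a) =
    pairings-hook-tooLong a′ as′ (length as) _ (diagonalHooks as) A′↓ (s≤s (ℕP.+-monoˡ-< (length as) a′<a))
  pairings-diagonalHooks-lex< (a ∷ as′) (a ∷ as) A′↓ len (next refl as′<as) =
    trans (pairings-hook-head a as′ (length as) (diagonalHooks as) A′↓)
          (pairings-diagonalHooks-lex< as′ as (AllPairs.tail A′↓) (ℕP.suc-injective len) as′<as)

  pairings-diagonalHooks-self : ∀ A → Decreasing A → pairings A (emptyBeta (length A)) (diagonalHooks A) ≡ 1ℤ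
  pairings-diagonalHooks-self []       _  = refl
  pairings-diagonalHooks-self (a ∷ as) A↓ =
    trans (pairings-hook-head a as (length as) (diagonalHooks as) A↓)
          (pairings-diagonalHooks-self as (AllPairs.tail A↓))

open Triangularity

module BeadLists where

  open import Data.Nat using (_+_)
  open import Algebra.Properties.CommutativeSemigroup ℕP.+-commutativeSemigroup using (x∙yz≈y∙xz)

  decreasing-∉-head : ∀ {x xs} → Decreasing (x ∷ xs) → ¬ (x ∈ xs)
  decreasing-∉-head (x>xs ∷ _) x∈xs = ℕP.<-irrefl refl (All.lookup x>xs x∈xs)

  decreasing-extensional : ∀ {xs ys} → Decreasing xs → Decreasing ys →
    (∀ {z} → z ∈ xs → z ∈ ys) → (∀ {z} → z ∈ ys → z ∈ xs) → xs ≡ ys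
  decreasing-extensional {[]}     {[]}     _ _ _ _ = refl
  decreasing-extensional {[]}     {y ∷ ys} _ _ _ ys⊆ with ys⊆ (here refl)
  ... | ()
  decreasing-extensional {x ∷ xs} {[]}     _ _ xs⊆ _ with xs⊆ (here refl)
  ... | ()
  decreasing-extensional {x ∷ xs} {y ∷ ys} (x>xs ∷ xs↓) (y>ys ∷ ys↓) xs⊆ ys⊆ =
    cong₂ _∷_ x≡y (decreasing-extensional xs↓ ys↓ tail⊆ tail⊇)
    where
    x≡y : x ≡ y
    x≡y with xs⊆ (here refl) | ys⊆ (here refl)
    ... | here x≡y  | _          = x≡y
    ... | there _   | here y≡x   = sym y≡x
    ... | there x∈ys | there y∈xs = ⊥-elim (ℕP.<-asym (All.lookup y>ys x∈ys) (All.lookup x>xs y∈xs))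
    tail⊆ : ∀ {z} → z ∈ xs → z ∈ ys
    tail⊆ z∈xs with xs⊆ (there z∈xs)
    ... | here z≡y  = ⊥-elim (ℕP.<-irrefl (trans z≡y (sym x≡y)) (All.lookup x>xs z∈xs))
    ... | there z∈ys = z∈ys
    tail⊇ : ∀ {z} → z ∈ ys → z ∈ xs
    tail⊇ z∈ys with ys⊆ (there z∈ys)
    ... | here z≡x  = ⊥-elim (ℕP.<-irrefl (trans z≡x x≡y) (All.lookup y>ys z∈ys))
    ... | there z∈xs = z∈xs

  memb≡does-∈? : ∀ a xs → memb a xs ≡ does (a ∈? xs)
  memb≡does-∈? a []       = refl
  memb≡does-∈? a (x ∷ xs) = cong ((a ≡ᵇ x) ∨_) (memb≡does-∈? a xs)

  ∈-remove⁻ : ∀ {a z} xs → z ∈ remove a xs → z ∈ xs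
  ∈-remove⁻ {a} (x ∷ xs) z∈ with a ≡ᵇ x
  ... | true = there z∈
  ∈-remove⁻ (x ∷ xs) (here z≡x)  | false = here z≡x
  ∈-remove⁻ (x ∷ xs) (there z∈)  | false = there (∈-remove⁻ xs z∈)

  ∈-remove⁺ : ∀ {a z} xs → z ∈ xs → z ≢ a → z ∈ remove a xs
  ∈-remove⁺ {a} (x ∷ xs) z∈ z≢a with a ≡ᵇ x in eq
  ∈-remove⁺ (x ∷ xs) (here z≡x) z≢a | true  = ⊥-elim (z≢a (trans z≡x (sym (does⇒ (_ ℕ.≟ x) eq))))
  ∈-remove⁺ (x ∷ xs) (there z∈) z≢a | true  = z∈
  ∈-remove⁺ (x ∷ xs) (here z≡x) z≢a | false = here z≡x
  ∈-remove⁺ (x ∷ xs) (there z∈) z≢a | false = there (∈-remove⁺ xs z∈ z≢a)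

  ∈-remove-≢ : ∀ {a z} xs → Decreasing xs → z ∈ remove a xs → z ≢ a
  ∈-remove-≢ {a} (x ∷ xs) xs↓ z∈ with a ≡ᵇ x in eq
  ∈-remove-≢ (x ∷ xs) xs↓ z∈         | true  = λ z≡a →
    decreasing-∉-head xs↓ (subst (_∈ xs) (trans z≡a (does⇒ (_ ℕ.≟ x) eq)) z∈)
  ∈-remove-≢ (x ∷ xs) xs↓ (here z≡x) | false = λ z≡a → does⇒¬ (_ ℕ.≟ x) eq (trans (sym z≡a) z≡x)
  ∈-remove-≢ (x ∷ xs) xs↓ (there z∈) | false = ∈-remove-≢ xs (AllPairs.tail xs↓) z∈

  remove-decreasing : ∀ {a} xs → Decreasing xs → Decreasing (remove a xs)
  remove-decreasing []       xs↓           = []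
  remove-decreasing {a} (x ∷ xs) (x>xs ∷ xs↓) with a ≡ᵇ x
  ... | true  = xs↓
  ... | false = All.tabulate (λ z∈ → All.lookup x>xs (∈-remove⁻ xs z∈)) ∷ remove-decreasing xs xs↓

  length-remove : ∀ {a} xs → a ∈ xs → suc (length (remove a xs)) ≡ length xs
  length-remove {a} (x ∷ xs) a∈ with a ≡ᵇ x in eq
  ... | true = refl
  length-remove (x ∷ xs) (here a≡x) | false = ⊥-elim (does⇒¬ (_ ℕ.≟ x) eq a≡x)
  length-remove (x ∷ xs) (there a∈) | false = cong suc (length-remove xs a∈)

  sum-remove : ∀ {a} xs → a ∈ xs → sum xs ≡ a + sum (remove a xs)
  sum-remove {a} (x ∷ xs) a∈ with a ≡ᵇ x in eq
  ... | true = cong (_+ sum xs) (sym (does⇒ (_ ℕ.≟ x) eq))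
  sum-remove (x ∷ xs) (here a≡x) | false = ⊥-elim (does⇒¬ (_ ℕ.≟ x) eq a≡x)
  sum-remove {a} (x ∷ xs) (there a∈) | false =
    trans (cong (x +_) (sum-remove xs a∈)) (x∙yz≈y∙xz x a (sum (remove a xs)))

  ∈-insertDesc⁻ : ∀ {a z} xs → z ∈ insertDesc a xs → z ≡ a ⊎ z ∈ xs
  ∈-insertDesc⁻ [] (here z≡a) = inj₁ z≡a
  ∈-insertDesc⁻ {a} (x ∷ xs) z∈ with x <ᵇ a
  ∈-insertDesc⁻ (x ∷ xs) (here z≡a) | true  = inj₁ z≡a
  ∈-insertDesc⁻ (x ∷ xs) (there z∈) | true  = inj₂ z∈
  ∈-insertDesc⁻ (x ∷ xs) (here z≡x) | false = inj₂ (here z≡x)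
  ∈-insertDesc⁻ (x ∷ xs) (there z∈) | false with ∈-insertDesc⁻ xs z∈
  ... | inj₁ z≡a  = inj₁ z≡a
  ... | inj₂ z∈xs = inj₂ (there z∈xs)

  ∈-insertDesc-self : ∀ a xs → a ∈ insertDesc a xs
  ∈-insertDesc-self a []       = here refl
  ∈-insertDesc-self a (x ∷ xs) with x <ᵇ a
  ... | true  = here refl
  ... | false = there (∈-insertDesc-self a xs)

  ∈-insertDesc⁺ : ∀ {a z} xs → z ∈ xs → z ∈ insertDesc a xs
  ∈-insertDesc⁺ {a} (x ∷ xs) z∈ with x <ᵇ a
  ... | true = there z∈
  ∈-insertDesc⁺ (x ∷ xs) (here z≡x) | false = here z≡x
  ∈-insertDesc⁺ (x ∷ xs) (there z∈) | false = there (∈-insertDesc⁺ xs z∈)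

  insertDesc-decreasing : ∀ {a} xs → Decreasing xs → ¬ (a ∈ xs) → Decreasing (insertDesc a xs)
  insertDesc-decreasing []       _  _   = [] ∷ []
  insertDesc-decreasing {a} (x ∷ xs) (x>xs ∷ xs↓) a∉ with x <ᵇ a in eq
  ... | true  = (x<a ∷ All.map (λ z<x → ℕP.<-trans z<x x<a) x>xs) ∷ x>xs ∷ xs↓
    where x<a = does⇒ (x ℕ.<? a) eq
  ... | false = All.tabulate below ∷ insertDesc-decreasing xs xs↓ (λ a∈ → a∉ (there a∈))
    where
    a<x : a < x
    a<x = ℕP.≤∧≢⇒< (ℕP.≮⇒≥ (does⇒¬ (x ℕ.<? a) eq)) (λ a≡x → a∉ (here a≡x))
    below : ∀ {z} → z ∈ insertDesc a xs → z < x
    below z∈ with ∈-insertDesc⁻ xs z∈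
    ... | inj₁ refl = a<x
    ... | inj₂ z∈xs = All.lookup x>xs z∈xs

  length-insertDesc : ∀ a xs → length (insertDesc a xs) ≡ suc (length xs)
  length-insertDesc a []       = refl
  length-insertDesc a (x ∷ xs) with x <ᵇ a
  ... | true  = refl
  ... | false = cong suc (length-insertDesc a xs)

  eqList⇒≡ : ∀ xs ys → eqList xs ys ≡ true → xs ≡ ys
  eqList⇒≡ []       []       _  = refl
  eqList⇒≡ (x ∷ xs) (y ∷ ys) eq with x ≡ᵇ y in x≡ᵇy
  ... | true = cong₂ _∷_ (does⇒ (x ℕ.≟ y) x≡ᵇy) (eqList⇒≡ xs ys eq)

  eqList-refl : ∀ xs → eqList xs xs ≡ true
  eqList-refl []       = refl
  eqList-refl (x ∷ xs) rewrite dec-true (x ℕ.≟ x) refl = eqList-refl xs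

open BeadLists

module Counting where

  open import Data.Nat using (_+_; _∸_)
  open import Relation.Nullary.Decidable using (T?)
  open import Relation.Unary using (Decidable)
  open import Data.List.Membership.Propositional.Properties using (∈-filter⁺; ∈-filter⁻)
  open import Algebra.Properties.CommutativeSemigroup ℕP.+-commutativeSemigroup using (x∙yz≈y∙xz)

  indicator : Bool → ℕ
  indicator b = if b then 1 else 0

  countᵇ : {A : Set} → (A → Bool) → List A → ℕ
  countᵇ f []       = 0
  countᵇ f (x ∷ xs) = indicator (f x) + countᵇ f xs

  indicator-mono : ∀ {b c} → (b ≡ true → c ≡ true) → indicator b ≤ indicator c
  indicator-mono {false} _   = z≤n
  indicator-mono {true}  b⇒c rewrite b⇒c refl = ℕP.≤-refl

  indicator-≤1 : ∀ b → indicator b ≤ 1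
  indicator-≤1 true  = ℕP.≤-refl
  indicator-≤1 false = z≤n

  module _ {A : Set} where

    countᵇ-≤ : ∀ (f g : A → Bool) xs → (∀ {x} → x ∈ xs → f x ≡ true → g x ≡ true) → countᵇ f xs ≤ countᵇ g xs
    countᵇ-≤ f g []       _   = z≤n
    countᵇ-≤ f g (x ∷ xs) f⇒g =
      ℕP.+-mono-≤ (indicator-mono (f⇒g (here refl))) (countᵇ-≤ f g xs (λ x∈ → f⇒g (there x∈)))

    countᵇ-< : ∀ (f g : A → Bool) xs {x₀} → (∀ {x} → x ∈ xs → f x ≡ true → g x ≡ true) →
      x₀ ∈ xs → g x₀ ≡ true → f x₀ ≡ false → countᵇ f xs < countᵇ g xs
    countᵇ-< f g (x ∷ xs) f⇒g (here refl) gx fx rewrite gx | fx = s≤s (countᵇ-≤ f g xs (λ x∈ → f⇒g (there x∈)))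
    countᵇ-< f g (x ∷ xs) f⇒g (there x₀∈) gx₀ fx₀ =
      ℕP.+-mono-≤-< (indicator-mono (f⇒g (here refl))) (countᵇ-< f g xs (λ x∈ → f⇒g (there x∈)) x₀∈ gx₀ fx₀)

  countᵇ-remove : ∀ (f : ℕ → Bool) {a} xs → a ∈ xs → countᵇ f xs ≡ indicator (f a) + countᵇ f (remove a xs)
  countᵇ-remove f {a} (x ∷ xs) a∈ with a ≡ᵇ x in eq
  ... | true = cong (λ t → indicator (f t) + countᵇ f xs) (sym (does⇒ (a ℕ.≟ x) eq))
  countᵇ-remove f (x ∷ xs) (here a≡x) | false = ⊥-elim (does⇒¬ (_ ℕ.≟ x) eq a≡x)
  countᵇ-remove f {a} (x ∷ xs) (there a∈) | false =
    trans (cong (indicator (f x) +_) (countᵇ-remove f xs a∈)) (x∙yz≈y∙xz (indicator (f x)) (indicator (f a)) _)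

  countᵇ-insertDesc : ∀ (f : ℕ → Bool) a xs → countᵇ f (insertDesc a xs) ≡ indicator (f a) + countᵇ f xs
  countᵇ-insertDesc f a []       = refl
  countᵇ-insertDesc f a (x ∷ xs) with x <ᵇ a
  ... | true  = refl
  ... | false = trans (cong (indicator (f x) +_) (countᵇ-insertDesc f a xs))
                      (x∙yz≈y∙xz (indicator (f x)) (indicator (f a)) (countᵇ f xs))

  countᵇ-++ : ∀ (f : ℕ → Bool) xs ys → countᵇ f (xs ++ ys) ≡ countᵇ f xs + countᵇ f ys
  countᵇ-++ f []       ys = refl
  countᵇ-++ f (x ∷ xs) ys =
    trans (cong (indicator (f x) +_) (countᵇ-++ f xs ys)) (sym (ℕP.+-assoc (indicator (f x)) _ _))

  countᵇ-true : ∀ (f : ℕ → Bool) xs → (∀ {x} → x ∈ xs → f x ≡ true) → countᵇ f xs ≡ length xs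
  countᵇ-true f []       _     = refl
  countᵇ-true f (x ∷ xs) all-t rewrite all-t (here refl) = cong suc (countᵇ-true f xs (λ x∈ → all-t (there x∈)))

  countᵇ-false : ∀ (f : ℕ → Bool) xs → (∀ {x} → x ∈ xs → f x ≡ false) → countᵇ f xs ≡ 0
  countᵇ-false f []       _     = refl
  countᵇ-false f (x ∷ xs) all-f rewrite all-f (here refl) = countᵇ-false f xs (λ x∈ → all-f (there x∈))

  countᵇ-cong : ∀ {f g : ℕ → Bool} xs → (∀ {x} → x ∈ xs → f x ≡ g x) → countᵇ f xs ≡ countᵇ g xs
  countᵇ-cong []       _   = refl
  countᵇ-cong (x ∷ xs) f≗g = cong₂ (λ u v → indicator u + v) (f≗g (here refl)) (countᵇ-cong xs (λ x∈ → f≗g (there x∈)))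

  countᵇ-map : ∀ {A : Set} (f : ℕ → Bool) (g : A → ℕ) xs → countᵇ f (map g xs) ≡ countᵇ (λ x → f (g x)) xs
  countᵇ-map f g []       = refl
  countᵇ-map f g (x ∷ xs) = cong (indicator (f (g x)) +_) (countᵇ-map f g xs)

  length-filter≡countᵇ : ∀ {P : ℕ → Set} (P? : Decidable P) xs → length (filter P? xs) ≡ countᵇ (λ x → does (P? x)) xs
  length-filter≡countᵇ P? []       = refl
  length-filter≡countᵇ P? (x ∷ xs) with does (P? x)
  ... | true  = cong suc (length-filter≡countᵇ P? xs)
  ... | false = length-filter≡countᵇ P? xs

  countᵇ-filter : ∀ {P : ℕ → Set} (P? : Decidable P) (f : ℕ → Bool) xs →
    countᵇ f (filter P? xs) ≡ countᵇ (λ x → f x ∧ does (P? x)) xs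
  countᵇ-filter P? f []       = refl
  countᵇ-filter P? f (x ∷ xs) with does (P? x)
  ... | true  with f x
  ...   | true  = cong suc (countᵇ-filter P? f xs)
  ...   | false = countᵇ-filter P? f xs
  countᵇ-filter P? f (x ∷ xs) | false with f x
  ...   | true  = countᵇ-filter P? f xs
  ...   | false = countᵇ-filter P? f xs

  countᵇ-split : ∀ (f g : ℕ → Bool) xs → countᵇ (λ y → f y ∧ g y) xs + countᵇ (λ y → f y ∧ not (g y)) xs ≡ countᵇ f xs
  countᵇ-split f g []       = refl
  countᵇ-split f g (x ∷ xs) with f x | g x
  ... | true  | true  = cong suc (countᵇ-split f g xs)
  ... | true  | false = trans (ℕP.+-suc _ _) (cong suc (countᵇ-split f g xs))
  ... | false | true  = countᵇ-split f g xs
  ... | false | false = countᵇ-split f g xs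

  countᵇ-staircase-shift : ∀ (g : ℕ → Bool) L →
    indicator (g 0) + countᵇ (λ y → g (suc y)) (emptyBeta L) ≡ indicator (g L) + countᵇ g (emptyBeta L)
  countᵇ-staircase-shift g zero    = refl
  countᵇ-staircase-shift g (suc L) = trans (x∙yz≈y∙xz (indicator (g 0)) (indicator (g (suc L))) _)
    (cong (indicator (g (suc L)) +_) (countᵇ-staircase-shift g L))

  countᵇ-staircase-reflect : ∀ (g : ℕ → Bool) L → countᵇ (λ x → g (L ∸ suc x)) (emptyBeta L) ≡ countᵇ g (emptyBeta L)
  countᵇ-staircase-reflect g zero    = refl
  countᵇ-staircase-reflect g (suc L) = begin
      indicator (g (L ∸ L)) + countᵇ (λ x → g (suc L ∸ suc x)) (emptyBeta L)
    ≡⟨ cong₂ (λ t u → indicator (g t) + u) (ℕP.n∸n≡0 L)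
         (countᵇ-cong (emptyBeta L) (λ {x} x∈ → cong g (ℕP.+-∸-assoc 1 (∈-staircase⁻ x∈)))) ⟩
      indicator (g 0) + countᵇ (λ x → g (suc (L ∸ suc x))) (emptyBeta L)
    ≡⟨ cong (indicator (g 0) +_) (countᵇ-staircase-reflect (λ y → g (suc y)) L) ⟩
      indicator (g 0) + countᵇ (λ y → g (suc y)) (emptyBeta L)
    ≡⟨ countᵇ-staircase-shift g L ⟩
      indicator (g L) + countᵇ g (emptyBeta L)
    ∎
    where open ≡-Reasoning

  countᵇ-<-staircase : ∀ b L → b ≤ L → countᵇ (_<ᵇ b) (emptyBeta L) ≡ b
  countᵇ-<-staircase b zero    z≤n = refl
  countᵇ-<-staircase b (suc L) b≤ with b ℕ.≟ suc L
  ... | yes refl rewrite dec-true (L ℕ.<? suc L) (ℕP.n<1+n L) =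
    cong suc (trans (countᵇ-true (_<ᵇ suc L) (emptyBeta L)
                      (λ x∈ → dec-true (_ ℕ.<? suc L) (ℕP.m<n⇒m<1+n (∈-staircase⁻ x∈))))
                    (length-staircase L))
  ... | no b≢ rewrite dec-false (L ℕ.<? b) (ℕP.≤⇒≯ (ℕP.≤-pred (ℕP.≤∧≢⇒< b≤ b≢))) =
    countᵇ-<-staircase b L (ℕP.≤-pred (ℕP.≤∧≢⇒< b≤ b≢))

  countᵇ-members-staircase : ∀ (f : ℕ → Bool) L B → Decreasing B → All (_< L) B →
    countᵇ (λ y → f y ∧ memb y B) (emptyBeta L) ≡ countᵇ f B
  countᵇ-members-staircase f L B B↓ B<L = sym (trans (cong (countᵇ f) B≡filter)
    (countᵇ-filter (λ y → T? (memb y B)) f (emptyBeta L)))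
    where
    B≡filter : B ≡ filter (λ y → T? (memb y B)) (emptyBeta L)
    B≡filter = decreasing-extensional B↓ (AllPairsP.filter⁺ _ (staircase-decreasing L))
      (λ y∈ → ∈-filter⁺ (λ y → T? (memb y B)) (∈-staircase⁺ (All.lookup B<L y∈))
                (subst T (sym (trans (memb≡does-∈? _ B) (dec-true (_ ∈? B) y∈))) _))
      (λ y∈ → does⇒ (_ ∈? B) (trans (sym (memb≡does-∈? _ B))
                (T⇒≡true (proj₂ (∈-filter⁻ (λ y → T? (memb y B)) {xs = emptyBeta L} y∈)))))
      where
      T⇒≡true : ∀ {b} → T b → b ≡ true
      T⇒≡true {true} _ = refl

  countᵇ-above-below : ∀ a A → Decreasing A → a ∈ A → suc (countᵇ (a <ᵇ_) A + countᵇ (_<ᵇ a) A) ≡ length A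
  countᵇ-above-below a (x ∷ A) (x>A ∷ A↓) (here refl)
    rewrite dec-false (a ℕ.<? a) (ℕP.<-irrefl refl) =
    cong suc (cong₂ _+_ (countᵇ-false (a <ᵇ_) A (λ y∈ → dec-false (a ℕ.<? _) (ℕP.<⇒≯ (All.lookup x>A y∈))))
                        (countᵇ-true (_<ᵇ a) A (λ y∈ → dec-true (_ ℕ.<? a) (All.lookup x>A y∈))))
  countᵇ-above-below a (x ∷ A) (x>A ∷ A↓) (there a∈)
    rewrite dec-true (a ℕ.<? x) (All.lookup x>A a∈) | dec-false (x ℕ.<? a) (ℕP.<⇒≯ (All.lookup x>A a∈)) =
    cong suc (countᵇ-above-below a A A↓ a∈)

open Counting

module MNVanishing where

  open import Data.Nat using (_+_; _∸_)
  open import Data.Integer using () renaming (_*_ to _*ℤ_)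

  move : ℕ → ℕ → List ℕ → List ℕ
  move b h β = insertDesc h (remove b β)

  length-move : ∀ {b} h β → b ∈ β → length (move b h β) ≡ length β
  length-move {b} h β b∈ = trans (length-insertDesc h (remove b β)) (length-remove β b∈)

  -- mn β (r ∷ rs) unfolds to ∑ β (mnTerm β r rs)
  mnTerm : List ℕ → ℕ → List ℕ → ℕ → ℤ
  mnTerm β r rs b = if (r ≤ᵇ b) ∧ not (memb (b ∸ r) β)
    then sgn (between (b ∸ r) b β) *ℤ mn (move b (b ∸ r) β) rs else 0ℤ

  mnTerm-vanishes : ∀ β r rs b → mn (move b (b ∸ r) β) rs ≡ 0ℤ → mnTerm β r rs b ≡ 0ℤ
  mnTerm-vanishes β r rs b mn≡0 with (r ≤ᵇ b) ∧ not (memb (b ∸ r) β)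
  ... | true  = trans (cong (sgn (between (b ∸ r) b β) *ℤ_) mn≡0) (ℤP.*-zeroʳ (sgn (between (b ∸ r) b β)))
  ... | false = refl

  mnTerm-blocked : ∀ β r rs b → (r ≤ᵇ b) ∧ not (memb (b ∸ r) β) ≡ false → mnTerm β r rs b ≡ 0ℤ
  mnTerm-blocked β r rs b blocked rewrite blocked = refl

  mnTerm-free : ∀ β r rs b → (r ≤ᵇ b) ∧ not (memb (b ∸ r) β) ≡ true →
    mnTerm β r rs b ≡ sgn (between (b ∸ r) b β) *ℤ mn (move b (b ∸ r) β) rs
  mnTerm-free β r rs b free rewrite free = refl

  highBeads : ℕ → List ℕ → ℕ
  highBeads L = countᵇ (L ≤ᵇ_)

  highBeads-staircase : ∀ L → highBeads L (emptyBeta L) ≡ 0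
  highBeads-staircase L = countᵇ-false (L ≤ᵇ_) (emptyBeta L) (λ x∈ → dec-false (L ℕ.≤? _) (ℕP.<⇒≱ (∈-staircase⁻ x∈)))

  highBeads-move : ∀ L {β b} h → b ∈ β →
    highBeads L (move b h β) + indicator (L ≤ᵇ b) ≡ highBeads L β + indicator (L ≤ᵇ h)
  highBeads-move L {β} {b} h b∈ = begin
      highBeads L (move b h β) + indicator (L ≤ᵇ b)
    ≡⟨ cong (_+ indicator (L ≤ᵇ b)) (countᵇ-insertDesc (L ≤ᵇ_) h (remove b β)) ⟩
      indicator (L ≤ᵇ h) + highBeads L (remove b β) + indicator (L ≤ᵇ b)
    ≡⟨ ℕP.+-assoc (indicator (L ≤ᵇ h)) _ _ ⟩
      indicator (L ≤ᵇ h) + (highBeads L (remove b β) + indicator (L ≤ᵇ b))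
    ≡⟨ cong (indicator (L ≤ᵇ h) +_) (ℕP.+-comm (highBeads L (remove b β)) _) ⟩
      indicator (L ≤ᵇ h) + (indicator (L ≤ᵇ b) + highBeads L (remove b β))
    ≡⟨ cong (indicator (L ≤ᵇ h) +_) (countᵇ-remove (L ≤ᵇ_) β b∈) ⟨
      indicator (L ≤ᵇ h) + highBeads L β
    ≡⟨ ℕP.+-comm (indicator (L ≤ᵇ h)) _ ⟩
      highBeads L β + indicator (L ≤ᵇ h)
    ∎
    where open ≡-Reasoning

  mn-vanishes : ∀ rs β → length rs < highBeads (length β) β → mn β rs ≡ 0ℤ
  mn-vanishes [] β few with eqList β (emptyBeta (length β)) in eq
  ... | true  = ⊥-elim (ℕP.<-irrefl (sym (trans (cong (highBeads (length β)) (eqList⇒≡ β _ eq))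
                                                   (highBeads-staircase (length β)))) few)
  ... | false = refl
  mn-vanishes (r ∷ rs) β few = ∑-zero β (λ {b} b∈ →
    mnTerm-vanishes β r rs b (mn-vanishes rs (move b (b ∸ r) β) (stillFew b∈)))
    where
    L = length β
    stillFew : ∀ {b} → b ∈ β → length rs < highBeads (length (move b (b ∸ r) β)) (move b (b ∸ r) β)
    stillFew {b} b∈ rewrite length-move (b ∸ r) β b∈ = ℕP.+-cancelʳ-< (indicator (L ≤ᵇ b)) (length rs) _ (begin-strict
        length rs + indicator (L ≤ᵇ b)
      ≤⟨ ℕP.+-monoʳ-≤ (length rs) (indicator-≤1 (L ≤ᵇ b)) ⟩
        length rs + 1
      ≡⟨ ℕP.+-comm (length rs) 1 ⟩
        suc (length rs)
      <⟨ few ⟩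
        highBeads L β
      ≤⟨ ℕP.m≤m+n (highBeads L β) _ ⟩
        highBeads L β + indicator (L ≤ᵇ (b ∸ r))
      ≡⟨ highBeads-move L (b ∸ r) b∈ ⟨
        highBeads L (move b (b ∸ r) β) + indicator (L ≤ᵇ b)
      ∎)
      where open ℕP.≤-Reasoning

open MNVanishing

module FrobeniusBeta where

  open import Data.Nat using (_+_; _∸_)
  open import Relation.Nullary using (¬?)
  open import Data.List.Membership.Propositional.Properties
    using (∈-map⁺; ∈-map⁻; ∈-++⁺ˡ; ∈-++⁺ʳ; ∈-++⁻; ∈-filter⁺; ∈-filter⁻)

  reflect-involutive : ∀ {L b} → b < L → L ∸ suc (L ∸ suc b) ≡ b
  reflect-involutive {suc L} (s≤s b≤L) = ℕP.m∸[m∸n]≡n b≤L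

  reflect-< : ∀ {L b} → b < L → L ∸ suc b < L
  reflect-< {suc L} {b} _ = s≤s (ℕP.m∸n≤m L b)

  -- the beads below L: position x is empty iff L - 1 - x is a leg
  lowBeads : ℕ → List ℕ → List ℕ
  lowBeads L B = filter (λ x → ¬? (L ∸ suc x ∈? B)) (emptyBeta L)

  frobeniusBeta : ℕ → List ℕ → List ℕ → List ℕ
  frobeniusBeta L A B = map (L +_) A ++ lowBeads L B

  ∈-lowBeads⁻ : ∀ {L B x} → x ∈ lowBeads L B → x < L × ¬ (L ∸ suc x ∈ B)
  ∈-lowBeads⁻ {L} {B} x∈ with ∈-filter⁻ (λ x → ¬? (L ∸ suc x ∈? B)) {xs = emptyBeta L} x∈
  ... | x∈δ , x∉ = ∈-staircase⁻ x∈δ , x∉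

  ∈-frobeniusBeta⁻ : ∀ {L A B x} → x ∈ frobeniusBeta L A B →
    (∃ λ a → a ∈ A × x ≡ L + a) ⊎ (x < L × ¬ (L ∸ suc x ∈ B))
  ∈-frobeniusBeta⁻ {L} {A} x∈ with ∈-++⁻ (map (L +_) A) x∈
  ... | inj₁ x∈high = inj₁ (∈-map⁻ (L +_) x∈high)
  ... | inj₂ x∈low  = inj₂ (∈-lowBeads⁻ x∈low)

  ∈-frobeniusBeta-high : ∀ {L A B a} → a ∈ A → L + a ∈ frobeniusBeta L A B
  ∈-frobeniusBeta-high {L} a∈ = ∈-++⁺ˡ (∈-map⁺ (L +_) a∈)

  ∈-frobeniusBeta-low : ∀ {L A B x} → x < L → ¬ (L ∸ suc x ∈ B) → x ∈ frobeniusBeta L A B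
  ∈-frobeniusBeta-low {L} {A} {B} x<L x∉ =
    ∈-++⁺ʳ (map (L +_) A) (∈-filter⁺ (λ x → ¬? (L ∸ suc x ∈? B)) (∈-staircase⁺ x<L) x∉)

  frobeniusBeta-decreasing : ∀ L {A} B → Decreasing A → Decreasing (frobeniusBeta L A B)
  frobeniusBeta-decreasing L {A} B A↓ = AllPairsP.++⁺
    (AllPairsP.map⁺ (AllPairs.map (ℕP.+-monoʳ-< L) A↓))
    (AllPairsP.filter⁺ _ (staircase-decreasing L))
    (AllP.map⁺ (All.tabulate (λ {a} _ → All.tabulate (λ x∈ →
      ℕP.<-≤-trans (proj₁ (∈-lowBeads⁻ {L} {B} x∈)) (ℕP.m≤m+n L a)))))

  highBeads-frobeniusBeta : ∀ L A B → highBeads L (frobeniusBeta L A B) ≡ length A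
  highBeads-frobeniusBeta L A B = begin
      highBeads L (map (L +_) A ++ lowBeads L B)
    ≡⟨ countᵇ-++ (L ≤ᵇ_) (map (L +_) A) (lowBeads L B) ⟩
      highBeads L (map (L +_) A) + highBeads L (lowBeads L B)
    ≡⟨ cong₂ _+_ (trans (countᵇ-map (L ≤ᵇ_) (L +_) A)
                         (countᵇ-true _ A (λ {a} _ → dec-true (L ℕ.≤? L + a) (ℕP.m≤m+n L a))))
                 (countᵇ-false (L ≤ᵇ_) (lowBeads L B)
                   (λ x∈ → dec-false (L ℕ.≤? _) (ℕP.<⇒≱ (proj₁ (∈-lowBeads⁻ {L} {B} x∈))))) ⟩
      length A + 0
    ≡⟨ ℕP.+-identityʳ (length A) ⟩
      length A
    ∎
    where open ≡-Reasoning

  frobeniusBeta-empty : ∀ L → frobeniusBeta L [] [] ≡ emptyBeta L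
  frobeniusBeta-empty L = ListP.filter-all _ (All.tabulate (λ _ ()))

  record Frobenius (L : ℕ) (A B : List ℕ) : Set where
    field
      arms-decreasing : Decreasing A
      legs-decreasing : Decreasing B
      legs-<          : All (_< L) B
      length-arms≡legs : length A ≡ length B
      length-beads    : length (frobeniusBeta L A B) ≡ L

  module _ {L A B a b} (F : Frobenius L A B) (a∈ : a ∈ A) (b∈ : b ∈ B) where

    open Frobenius F

    private
      β = frobeniusBeta L A B
      h = L ∸ suc b
      b<L : b < L
      b<L = All.lookup legs-< b∈
      h<L : h < L
      h<L = reflect-< b<L
      β↓ : Decreasing β
      β↓ = frobeniusBeta-decreasing L B arms-decreasing

    hookTarget-free : ¬ (L ∸ suc b ∈ frobeniusBeta L A B)
    hookTarget-free h∈ with ∈-frobeniusBeta⁻ {L} {A} {B} h∈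
    ... | inj₁ (a′ , _ , h≡) = ℕP.<⇒≱ h<L (subst (L ≤_) (sym h≡) (ℕP.m≤m+n L a′))
    ... | inj₂ (_ , h∉)      = h∉ (subst (_∈ B) (sym (reflect-involutive b<L)) b∈)

    move-frobeniusBeta : move (L + a) (L ∸ suc b) (frobeniusBeta L A B) ≡ frobeniusBeta L (remove a A) (remove b B)
    move-frobeniusBeta = decreasing-extensional
      (insertDesc-decreasing (remove (L + a) β) (remove-decreasing β β↓) (λ h∈ → hookTarget-free (∈-remove⁻ β h∈)))
      (frobeniusBeta-decreasing L (remove b B) (remove-decreasing A arms-decreasing))
      forth back
      where
      forth : ∀ {z} → z ∈ move (L + a) h β → z ∈ frobeniusBeta L (remove a A) (remove b B)
      forth z∈ with ∈-insertDesc⁻ (remove (L + a) β) z∈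
      ... | inj₁ refl = ∈-frobeniusBeta-low h<L (λ h∈ → ∈-remove-≢ B legs-decreasing h∈ (reflect-involutive b<L))
      ... | inj₂ z∈′ with ∈-frobeniusBeta⁻ {L} {A} {B} (∈-remove⁻ β z∈′)
      ...   | inj₁ (a′ , a′∈ , refl) = ∈-frobeniusBeta-high (∈-remove⁺ A a′∈ (λ a′≡a → ∈-remove-≢ β β↓ z∈′ (cong (L +_) a′≡a)))
      ...   | inj₂ (z<L , z∉)        = ∈-frobeniusBeta-low z<L (λ z∈B → z∉ (∈-remove⁻ B z∈B))
      back : ∀ {z} → z ∈ frobeniusBeta L (remove a A) (remove b B) → z ∈ move (L + a) h β
      back {z} z∈ with ∈-frobeniusBeta⁻ {L} {remove a A} {remove b B} z∈
      ... | inj₁ (a′ , a′∈ , refl) = ∈-insertDesc⁺ (remove (L + a) β)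
            (∈-remove⁺ β (∈-frobeniusBeta-high (∈-remove⁻ A a′∈))
              (λ eq → ∈-remove-≢ A arms-decreasing a′∈ (ℕP.+-cancelˡ-≡ L a′ a eq)))
      ... | inj₂ (z<L , z∉) with (L ∸ suc z) ℕ.≟ b
      ...   | yes z↦b  = subst (_∈ move (L + a) h β) (trans (cong (λ t → L ∸ suc t) (sym z↦b)) (reflect-involutive z<L))
                           (∈-insertDesc-self h (remove (L + a) β))
      ...   | no  ≢b   = ∈-insertDesc⁺ (remove (L + a) β)
              (∈-remove⁺ β (∈-frobeniusBeta-low z<L (λ z∈B → z∉ (∈-remove⁺ B z∈B ≢b)))
                (λ z≡ → ℕP.<⇒≱ z<L (subst (L ≤_) (sym z≡) (ℕP.m≤m+n L a))))

    Frobenius-removeHook : Frobenius L (remove a A) (remove b B)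
    Frobenius-removeHook = record
      { arms-decreasing  = remove-decreasing A arms-decreasing
      ; legs-decreasing  = remove-decreasing B legs-decreasing
      ; legs-<           = All.tabulate (λ b′∈ → All.lookup legs-< (∈-remove⁻ B b′∈))
      ; length-arms≡legs = ℕP.suc-injective (trans (length-remove A a∈) (trans length-arms≡legs (sym (length-remove B b∈))))
      ; length-beads     = trans (cong length (sym move-frobeniusBeta))
                                 (trans (length-move h β (∈-frobeniusBeta-high a∈)) length-beads)
      }

open FrobeniusBeta

module BeadsBetween where

  open import Data.Nat using (_+_; _∸_)
  open import Relation.Nullary using (_×-dec_)
  import Data.Bool.Properties as BoolP

  reflect-<-swap : ∀ {L b x} → b < L → x < L → (L ∸ suc b < x) → (L ∸ suc x < b)
  reflect-<-swap {suc L} {b} {x} (s≤s b≤L) (s≤s x≤L) L-b<x = ℕP.+-cancelʳ-< x (L ∸ x) b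
    (subst (_< b + x) (sym (ℕP.m∸n+n≡m x≤L))
      (subst (L <_) (ℕP.+-comm x b) (subst (_< x + b) (ℕP.m∸n+n≡m b≤L) (ℕP.+-monoˡ-< b L-b<x))))

  reflect-<ᵇ : ∀ {L b x} → b < L → x < L → ((L ∸ suc b) <ᵇ x) ≡ ((L ∸ suc x) <ᵇ b)
  reflect-<ᵇ b<L x<L = does-cong (_ ℕ.<? _) (_ ℕ.<? _) (reflect-<-swap b<L x<L) (reflect-<-swap x<L b<L)

  inRange : ℕ → ℕ → ℕ → Bool
  inRange lo hi x = does ((lo ℕ.<? x) ×-dec (x ℕ.<? hi))

  freeBelow : ℕ → List ℕ → ℕ → Bool
  freeBelow b₀ B y = (y <ᵇ b₀) ∧ not (memb y B)

  countᵇ-inRange-arms : ∀ L A a {h} → h < L → countᵇ (inRange h (L + a)) (map (L +_) A) ≡ countᵇ (_<ᵇ a) A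
  countᵇ-inRange-arms L A a {h} h<L = trans (countᵇ-map (inRange h (L + a)) (L +_) A) (countᵇ-cong A (λ {a′} _ →
    trans (cong (_∧ ((L + a′) <ᵇ (L + a))) (dec-true (h ℕ.<? L + a′) (ℕP.<-≤-trans h<L (ℕP.m≤m+n L a′))))
          (does-cong (L + a′ ℕ.<? L + a) (a′ ℕ.<? a) (ℕP.+-cancelˡ-< L a′ a) (ℕP.+-monoʳ-< L))))

  countᵇ-inRange-lowBeads : ∀ L B a {b₀} → b₀ < L →
    countᵇ (inRange (L ∸ suc b₀) (L + a)) (lowBeads L B) ≡ countᵇ (freeBelow b₀ B) (emptyBeta L)
  countᵇ-inRange-lowBeads L B a {b₀} b₀<L = trans (countᵇ-filter _ (inRange h (L + a)) (emptyBeta L))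
    (trans (countᵇ-cong (emptyBeta L) (λ {x} x∈ → reflected x (∈-staircase⁻ x∈)))
           (countᵇ-staircase-reflect (freeBelow b₀ B) L))
    where
    h = L ∸ suc b₀
    reflected : ∀ x → x < L → inRange h (L + a) x ∧ not (does (L ∸ suc x ∈? B)) ≡ freeBelow b₀ B (L ∸ suc x)
    reflected x x<L = cong₂ _∧_
      (trans (cong ((h <ᵇ x) ∧_) (dec-true (x ℕ.<? L + a) (ℕP.<-≤-trans x<L (ℕP.m≤m+n L a))))
        (trans (BoolP.∧-identityʳ (h <ᵇ x)) (reflect-<ᵇ b₀<L x<L)))
      (cong not (sym (memb≡does-∈? (L ∸ suc x) B)))

  countᵇ-freeBelow : ∀ L B b₀ → Decreasing B → All (_< L) B → b₀ ≤ L →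
    countᵇ (freeBelow b₀ B) (emptyBeta L) + countᵇ (_<ᵇ b₀) B ≡ b₀
  countᵇ-freeBelow L B b₀ B↓ B<L b₀≤L = begin
      countᵇ (freeBelow b₀ B) (emptyBeta L) + countᵇ (_<ᵇ b₀) B
    ≡⟨ cong (countᵇ (freeBelow b₀ B) (emptyBeta L) +_) (countᵇ-members-staircase (_<ᵇ b₀) L B B↓ B<L) ⟨
      countᵇ (freeBelow b₀ B) (emptyBeta L) + countᵇ (λ y → (y <ᵇ b₀) ∧ memb y B) (emptyBeta L)
    ≡⟨ ℕP.+-comm (countᵇ (freeBelow b₀ B) (emptyBeta L)) _ ⟩
      countᵇ (λ y → (y <ᵇ b₀) ∧ memb y B) (emptyBeta L) + countᵇ (freeBelow b₀ B) (emptyBeta L)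
    ≡⟨ countᵇ-split (_<ᵇ b₀) (λ y → memb y B) (emptyBeta L) ⟩
      countᵇ (_<ᵇ b₀) (emptyBeta L)
    ≡⟨ countᵇ-<-staircase b₀ L b₀≤L ⟩
      b₀
    ∎
    where open ≡-Reasoning

  -- The beads strictly between L - 1 - b₀ and L + a are the L + a′ with a′ < a and the low beads above
  -- L - 1 - b₀; of those b₀ positions, the empty ones are the L - 1 - b with b a leg below b₀.
  between-frobeniusBeta : ∀ L A B a b₀ → Decreasing B → All (_< L) B → b₀ < L →
    between (L ∸ suc b₀) (L + a) (frobeniusBeta L A B) + countᵇ (_<ᵇ b₀) B ≡ countᵇ (_<ᵇ a) A + b₀
  between-frobeniusBeta L A B a b₀ B↓ B<L b₀<L = begin
      between h (L + a) (frobeniusBeta L A B) + countᵇ (_<ᵇ b₀) B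
    ≡⟨ cong (_+ countᵇ (_<ᵇ b₀) B) (trans (length-filter≡countᵇ _ (frobeniusBeta L A B))
                                          (countᵇ-++ (inRange h (L + a)) (map (L +_) A) (lowBeads L B))) ⟩
      countᵇ (inRange h (L + a)) (map (L +_) A) + countᵇ (inRange h (L + a)) (lowBeads L B) + countᵇ (_<ᵇ b₀) B
    ≡⟨ cong₂ (λ u v → u + v + countᵇ (_<ᵇ b₀) B)
             (countᵇ-inRange-arms L A a (reflect-< b₀<L)) (countᵇ-inRange-lowBeads L B a b₀<L) ⟩
      countᵇ (_<ᵇ a) A + countᵇ (freeBelow b₀ B) (emptyBeta L) + countᵇ (_<ᵇ b₀) B
    ≡⟨ ℕP.+-assoc (countᵇ (_<ᵇ a) A) _ _ ⟩
      countᵇ (_<ᵇ a) A + (countᵇ (freeBelow b₀ B) (emptyBeta L) + countᵇ (_<ᵇ b₀) B)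
    ≡⟨ cong (countᵇ (_<ᵇ a) A +_) (countᵇ-freeBelow L B b₀ B↓ B<L (ℕP.<⇒≤ b₀<L)) ⟩
      countᵇ (_<ᵇ a) A + b₀
    ∎
    where
    open ≡-Reasoning
    h = L ∸ suc b₀

open BeadsBetween

module Signs where

  open import Data.Nat using (_+_)
  open import Data.Integer using (-_) renaming (_*_ to _*ℤ_; _+_ to _+ℤ_)
  open import Data.Nat.Tactic.RingSolver using (solve-∀)

  sgn-suc : ∀ m → sgn (suc m) ≡ - sgn m
  sgn-suc zero          = refl
  sgn-suc (suc zero)    = refl
  sgn-suc (suc (suc m)) = sgn-suc m

  sgn-+ : ∀ m n → sgn (m + n) ≡ sgn m *ℤ sgn n
  sgn-+ zero    n = sym (ℤP.*-identityˡ (sgn n))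
  sgn-+ (suc m) n = begin
      sgn (suc (m + n))     ≡⟨ sgn-suc (m + n) ⟩
      - sgn (m + n)         ≡⟨ cong -_ (sgn-+ m n) ⟩
      - (sgn m *ℤ sgn n)    ≡⟨ ℤP.neg-distribˡ-* (sgn m) (sgn n) ⟩
      - sgn m *ℤ sgn n      ≡⟨ cong (_*ℤ sgn n) (sgn-suc m) ⟨
      sgn (suc m) *ℤ sgn n  ∎
    where open ≡-Reasoning

  sgn-square : ∀ m → sgn m *ℤ sgn m ≡ 1ℤ
  sgn-square zero          = refl
  sgn-square (suc zero)    = refl
  sgn-square (suc (suc m)) = sgn-square m

  sgn-double : ∀ m n → sgn (m + (n + n)) ≡ sgn m
  sgn-double m n = begin
      sgn (m + (n + n))             ≡⟨ sgn-+ m (n + n) ⟩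
      sgn m *ℤ sgn (n + n)          ≡⟨ cong (sgn m *ℤ_) (trans (sgn-+ n n) (sgn-square n)) ⟩
      sgn m *ℤ 1ℤ                   ≡⟨ ℤP.*-identityʳ (sgn m) ⟩
      sgn m                         ∎
    where open ≡-Reasoning

  -- btw counts the beads a hook removal jumps over; ltA, gtA (ltB, gtB) count the arms (legs) below and above it
  hook-sign : ∀ btw ltB ltA b₀ gtA gtB → btw + ltB ≡ ltA + b₀ → gtA + ltA ≡ gtB + ltB →
    sgn btw *ℤ sgn gtB ≡ sgn b₀ *ℤ sgn gtA
  hook-sign btw ltB ltA b₀ gtA gtB e₁ e₂ = begin
      sgn btw *ℤ sgn gtB            ≡⟨ sgn-+ btw gtB ⟨
      sgn (btw + gtB)               ≡⟨ sgn-double (btw + gtB) ltB ⟨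
      sgn (btw + gtB + (ltB + ltB)) ≡⟨ cong sgn (begin
          btw + gtB + (ltB + ltB)     ≡⟨ regroup btw gtB ltB ⟩
          (btw + ltB) + (gtB + ltB)   ≡⟨ cong₂ _+_ e₁ (sym e₂) ⟩
          (ltA + b₀) + (gtA + ltA)    ≡⟨ regroup′ ltA b₀ gtA ⟩
          b₀ + gtA + (ltA + ltA)      ∎) ⟩
      sgn (b₀ + gtA + (ltA + ltA))  ≡⟨ sgn-double (b₀ + gtA) ltA ⟩
      sgn (b₀ + gtA)                ≡⟨ sgn-+ b₀ gtA ⟩
      sgn b₀ *ℤ sgn gtA             ∎
    where
    open ≡-Reasoning
    regroup : ∀ x y z → x + y + (z + z) ≡ (x + z) + (y + z)
    regroup = solve-∀
    regroup′ : ∀ x y z → (x + y) + (z + x) ≡ y + z + (x + x)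
    regroup′ = solve-∀

  altSum-decreasing : ∀ F xs → Decreasing xs →
    altSum F xs ≡ ∑ xs (λ z → sgn (countᵇ (z <ᵇ_) xs) *ℤ F z (remove z xs))
  altSum-decreasing F []       _            = refl
  altSum-decreasing F (x ∷ xs) (x>xs ∷ xs↓) = cong₂ _+ℤ_ first (trans
    (cong -_ (altSum-decreasing (λ y ys → F y (x ∷ ys)) xs xs↓))
    (trans (sym (∑-neg _ xs)) (∑-cong xs later)))
    where
    first : F x xs ≡ sgn (countᵇ (x <ᵇ_) (x ∷ xs)) *ℤ F x (remove x (x ∷ xs))
    first rewrite dec-false (x ℕ.<? x) (ℕP.<-irrefl refl) | dec-true (x ℕ.≟ x) refl
                | countᵇ-false (x <ᵇ_) xs (λ z∈ → dec-false (x ℕ.<? _) (ℕP.<⇒≯ (All.lookup x>xs z∈))) =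
      sym (ℤP.*-identityˡ (F x xs))
    later : ∀ {z} → z ∈ xs →
      - (sgn (countᵇ (z <ᵇ_) xs) *ℤ F z (x ∷ remove z xs)) ≡ sgn (countᵇ (z <ᵇ_) (x ∷ xs)) *ℤ F z (remove z (x ∷ xs))
    later {z} z∈ rewrite dec-true (z ℕ.<? x) (All.lookup x>xs z∈)
                       | dec-false (z ℕ.≟ x) (λ z≡x → ℕP.<-irrefl z≡x (All.lookup x>xs z∈)) =
      trans (ℤP.neg-distribˡ-* (sgn (countᵇ (z <ᵇ_) xs)) _)
            (cong (_*ℤ F z (x ∷ remove z xs)) (sym (sgn-suc (countᵇ (z <ᵇ_) xs))))

  ∑-single : ∀ (f : ℕ → ℤ) {x₀} xs → Decreasing xs → x₀ ∈ xs → (∀ {x} → x ∈ xs → x ≢ x₀ → f x ≡ 0ℤ) →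
    ∑ xs f ≡ f x₀
  ∑-single f (x ∷ xs) xs↓ (here refl) others = trans
    (cong (f x +ℤ_) (∑-zero xs (λ y∈ → others (there y∈) (λ y≡x → decreasing-∉-head xs↓ (subst (_∈ xs) y≡x y∈)))))
    (ℤP.+-identityʳ (f x))
  ∑-single f (x ∷ xs) xs↓ (there x₀∈) others = trans
    (cong (_+ℤ ∑ xs f) (others (here refl) (λ x≡x₀ → decreasing-∉-head xs↓ (subst (_∈ xs) (sym x≡x₀) x₀∈))))
    (trans (ℤP.+-identityˡ _) (∑-single f xs (AllPairs.tail xs↓) x₀∈ (λ y∈ → others (there y∈))))

open Signs

module CharactersViaPairings where

  open import Data.Nat using (_+_; _∸_)
  open import Data.Integer using () renaming (_*_ to _*ℤ_; _+_ to _+ℤ_)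
  open import Data.Integer.Tactic.RingSolver using (solve-∀)
  import Data.Bool.Properties as BoolP

  module HookStep {L A B} (F : Frobenius L A B) (r : ℕ) (rs : List ℕ) (len : suc (length rs) ≡ length A)
    (ih : ∀ {A′ B′} → Frobenius L A′ B′ → length rs ≡ length A′ →
          mn (frobeniusBeta L A′ B′) rs ≡ sgn (sum B′) *ℤ pairings A′ B′ rs) where

    open Frobenius F

    β : List ℕ
    β = frobeniusBeta L A B

    legSum : ℕ → ℤ
    legSum a = ∑ B (λ b → sgn (countᵇ (b <ᵇ_) B) *ℤ when (suc (a + b) ≡ᵇ r) (pairings (remove a A) (remove b B) rs))

    armSide : ℕ → ℤ
    armSide a = sgn (sum B) *ℤ (sgn (countᵇ (a <ᵇ_) A) *ℤ legSum a)

    pairings-via-legSum : pairings A B (r ∷ rs) ≡ ∑ A (λ a → sgn (countᵇ (a <ᵇ_) A) *ℤ legSum a)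
    pairings-via-legSum = trans (altSum-decreasing _ A arms-decreasing) (∑-cong A (λ {a} _ →
      cong (sgn (countᵇ (a <ᵇ_) A) *ℤ_) (altSum-decreasing _ B legs-decreasing)))

    move-vanishes : ∀ {b h} → b ∈ β → indicator (L ≤ᵇ b) ≤ indicator (L ≤ᵇ h) → mn (move b h β) rs ≡ 0ℤ
    move-vanishes {b} {h} b∈ b≤h = mn-vanishes rs (move b h β)
      (subst (λ t → length rs < highBeads t (move b h β)) (sym (trans (length-move h β b∈) length-beads)) stillFull)
      where
      stillFull : length rs < highBeads L (move b h β)
      stillFull = ℕP.+-cancelʳ-≤ (indicator (L ≤ᵇ b)) (suc (length rs)) _ (begin
          suc (length rs) + indicator (L ≤ᵇ b)  ≤⟨ ℕP.+-monoʳ-≤ (suc (length rs)) b≤h ⟩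
          suc (length rs) + indicator (L ≤ᵇ h)  ≡⟨ cong (_+ indicator (L ≤ᵇ h)) (trans len (sym (highBeads-frobeniusBeta L A B))) ⟩
          highBeads L β + indicator (L ≤ᵇ h)    ≡⟨ highBeads-move L h b∈ ⟨
          highBeads L (move b h β) + indicator (L ≤ᵇ b) ∎)
        where open ℕP.≤-Reasoning

    lowBead-vanishes : ∀ {x} → x ∈ lowBeads L B → mnTerm β r rs x ≡ 0ℤ
    lowBead-vanishes {x} x∈ with ∈-lowBeads⁻ {L} {B} x∈
    ... | x<L , x∉ = mnTerm-vanishes β r rs x (move-vanishes (∈-frobeniusBeta-low x<L x∉)
      (subst (λ t → indicator t ≤ indicator (L ≤ᵇ (x ∸ r))) (sym (dec-false (L ℕ.≤? x) (ℕP.<⇒≱ x<L))) z≤n))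

    armSide-vanishes : ∀ a → (∀ {b} → b ∈ B → suc (a + b) ≢ r) → armSide a ≡ 0ℤ
    armSide-vanishes a noHook = begin
        sgn (sum B) *ℤ (sgn (countᵇ (a <ᵇ_) A) *ℤ legSum a)
      ≡⟨ cong (λ t → sgn (sum B) *ℤ (sgn (countᵇ (a <ᵇ_) A) *ℤ t)) (∑-zero B (λ {b} b∈ →
           trans (cong (sgn (countᵇ (b <ᵇ_) B) *ℤ_) (when-≢ _ r _ (noHook b∈))) (ℤP.*-zeroʳ (sgn (countᵇ (b <ᵇ_) B))))) ⟩
        sgn (sum B) *ℤ (sgn (countᵇ (a <ᵇ_) A) *ℤ 0ℤ)
      ≡⟨ cong (sgn (sum B) *ℤ_) (ℤP.*-zeroʳ (sgn (countᵇ (a <ᵇ_) A))) ⟩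
        sgn (sum B) *ℤ 0ℤ
      ≡⟨ ℤP.*-zeroʳ (sgn (sum B)) ⟩
        0ℤ
      ∎
      where open ≡-Reasoning

    armTerm-short : ∀ {a} → a ∈ A → r ≤ a → mnTerm β r rs (L + a) ≡ armSide a
    armTerm-short {a} a∈ r≤a = trans
      (mnTerm-vanishes β r rs (L + a) (move-vanishes (∈-frobeniusBeta-high a∈) (ℕP.≤-reflexive (cong indicator
        (trans (dec-true (L ℕ.≤? L + a) (ℕP.m≤m+n L a))
               (sym (dec-true (L ℕ.≤? L + a ∸ r) (subst (L ≤_) (sym (ℕP.+-∸-assoc L r≤a)) (ℕP.m≤m+n L (a ∸ r))))))))))
      (sym (armSide-vanishes a (λ _ hook≡r → ℕP.<-irrefl refl (ℕP.<-≤-trans (s≤s (ℕP.m≤m+n a _)) (subst (_≤ a) (sym hook≡r) r≤a)))))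

    hookTarget : ∀ {a b₀} → suc (a + b₀) ≡ r → L + a ∸ r ≡ L ∸ suc b₀
    hookTarget {a} {b₀} hook≡r = begin
      L + a ∸ r                 ≡⟨ cong (L + a ∸_) (sym hook≡r) ⟩
      L + a ∸ suc (a + b₀)      ≡⟨ cong₂ _∸_ (ℕP.+-comm L a) (sym (ℕP.+-suc a b₀)) ⟩
      a + L ∸ (a + suc b₀)      ≡⟨ ℕP.[m+n]∸[m+o]≡n∸o a L (suc b₀) ⟩
      L ∸ suc b₀                ∎
      where open ≡-Reasoning

    legSum-hook : ∀ {a b₀} → b₀ ∈ B → suc (a + b₀) ≡ r →
      legSum a ≡ sgn (countᵇ (b₀ <ᵇ_) B) *ℤ pairings (remove a A) (remove b₀ B) rs
    legSum-hook {a} {b₀} b₀∈ hook≡r = trans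
      (∑-single _ B legs-decreasing b₀∈ (λ {b} _ b≢b₀ → trans
        (cong (sgn (countᵇ (b <ᵇ_) B) *ℤ_) (when-≢ _ r _ (λ e → b≢b₀ (ℕP.+-cancelˡ-≡ a b b₀ (ℕP.suc-injective (trans e (sym hook≡r)))))))
        (ℤP.*-zeroʳ (sgn (countᵇ (b <ᵇ_) B)))))
      (cong (sgn (countᵇ (b₀ <ᵇ_) B) *ℤ_) (trans (cong (λ t → when (t ≡ᵇ r) _) hook≡r) (when-refl r _)))

    signs-rearrange : ∀ X V W U S g → X *ℤ V ≡ S *ℤ U → V *ℤ V ≡ 1ℤ → X *ℤ (W *ℤ g) ≡ (S *ℤ W) *ℤ (U *ℤ (V *ℤ g))
    signs-rearrange X V W U S g XV≡SU V²≡1 = begin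
        X *ℤ (W *ℤ g)                    ≡⟨ ℤP.*-identityʳ _ ⟨
        X *ℤ (W *ℤ g) *ℤ 1ℤ              ≡⟨ cong (X *ℤ (W *ℤ g) *ℤ_) V²≡1 ⟨
        X *ℤ (W *ℤ g) *ℤ (V *ℤ V)        ≡⟨ regroup X V W g ⟩
        (X *ℤ V) *ℤ (W *ℤ (V *ℤ g))      ≡⟨ cong (_*ℤ (W *ℤ (V *ℤ g))) XV≡SU ⟩
        (S *ℤ U) *ℤ (W *ℤ (V *ℤ g))      ≡⟨ regroup′ S U W V g ⟩
        (S *ℤ W) *ℤ (U *ℤ (V *ℤ g))      ∎
      where
      open ≡-Reasoning
      regroup : ∀ X V W g → X *ℤ (W *ℤ g) *ℤ (V *ℤ V) ≡ (X *ℤ V) *ℤ (W *ℤ (V *ℤ g))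
      regroup = solve-∀
      regroup′ : ∀ S U W V g → (S *ℤ U) *ℤ (W *ℤ (V *ℤ g)) ≡ (S *ℤ W) *ℤ (U *ℤ (V *ℤ g))
      regroup′ = solve-∀

    armTerm-hook : ∀ {a b₀} → a ∈ A → b₀ ∈ B → suc (a + b₀) ≡ r → mnTerm β r rs (L + a) ≡ armSide a
    armTerm-hook {a} {b₀} a∈ b₀∈ hook≡r = begin
        mnTerm β r rs (L + a)
      ≡⟨ mnTerm-free β r rs (L + a) free ⟩
        sgn (between (L + a ∸ r) (L + a) β) *ℤ mn (move (L + a) (L + a ∸ r) β) rs
      ≡⟨ cong (λ t → sgn (between t (L + a) β) *ℤ mn (move (L + a) t β) rs) (hookTarget hook≡r) ⟩
        sgn btw *ℤ mn (move (L + a) (L ∸ suc b₀) β) rs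
      ≡⟨ cong (λ t → sgn btw *ℤ mn t rs) (move-frobeniusBeta F a∈ b₀∈) ⟩
        sgn btw *ℤ mn (frobeniusBeta L (remove a A) (remove b₀ B)) rs
      ≡⟨ cong (sgn btw *ℤ_) (ih (Frobenius-removeHook F a∈ b₀∈) (ℕP.suc-injective (trans len (sym (length-remove A a∈))))) ⟩
        sgn btw *ℤ (sgn (sum (remove b₀ B)) *ℤ pairings (remove a A) (remove b₀ B) rs)
      ≡⟨ signs-rearrange (sgn btw) (sgn (countᵇ (b₀ <ᵇ_) B)) (sgn (sum (remove b₀ B))) (sgn (countᵇ (a <ᵇ_) A))
           (sgn b₀) _ (hook-sign btw (countᵇ (_<ᵇ b₀) B) (countᵇ (_<ᵇ a) A) b₀ (countᵇ (a <ᵇ_) A) (countᵇ (b₀ <ᵇ_) B)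
             (between-frobeniusBeta L A B a b₀ legs-decreasing legs-< b₀<L) arms≡legs)
           (sgn-square (countᵇ (b₀ <ᵇ_) B)) ⟩
        (sgn b₀ *ℤ sgn (sum (remove b₀ B))) *ℤ
          (sgn (countᵇ (a <ᵇ_) A) *ℤ (sgn (countᵇ (b₀ <ᵇ_) B) *ℤ pairings (remove a A) (remove b₀ B) rs))
      ≡⟨ cong₂ (λ u v → u *ℤ (sgn (countᵇ (a <ᵇ_) A) *ℤ v))
           (trans (sym (sgn-+ b₀ (sum (remove b₀ B)))) (cong sgn (sym (sum-remove B b₀∈))))
           (sym (legSum-hook b₀∈ hook≡r)) ⟩
        armSide a
      ∎
      where
      open ≡-Reasoning
      btw = between (L ∸ suc b₀) (L + a) β
      b₀<L = All.lookup legs-< b₀∈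
      arms≡legs : countᵇ (a <ᵇ_) A + countᵇ (_<ᵇ a) A ≡ countᵇ (b₀ <ᵇ_) B + countᵇ (_<ᵇ b₀) B
      arms≡legs = ℕP.suc-injective (trans (countᵇ-above-below a A arms-decreasing a∈)
        (trans length-arms≡legs (sym (countᵇ-above-below b₀ B legs-decreasing b₀∈))))
      free : (r ≤ᵇ L + a) ∧ not (memb (L + a ∸ r) β) ≡ true
      free = cong₂ (λ u v → u ∧ not v)
        (dec-true (r ℕ.≤? L + a) (subst (_≤ L + a) hook≡r (subst (suc (a + b₀) ≤_) (ℕP.+-comm a L)
          (subst (_≤ a + L) (ℕP.+-suc a b₀) (ℕP.+-monoʳ-≤ a b₀<L)))))
        (trans (cong (λ t → memb t β) (hookTarget hook≡r))
               (trans (memb≡does-∈? _ β) (dec-false (_ ∈? β) (hookTarget-free F a∈ b₀∈))))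

    armTerm-blocked : ∀ {a b₀} → suc (a + b₀) ≡ r → ¬ (b₀ ∈ B) → mnTerm β r rs (L + a) ≡ armSide a
    armTerm-blocked {a} {b₀} hook≡r b₀∉ = trans (mnTerm-blocked β r rs (L + a) blocked)
      (sym (armSide-vanishes a (λ {b} b∈ hook′≡r →
        b₀∉ (subst (_∈ B) (ℕP.+-cancelˡ-≡ a b b₀ (ℕP.suc-injective (trans hook′≡r (sym hook≡r)))) b∈))))
      where
      blocked : (r ≤ᵇ L + a) ∧ not (memb (L + a ∸ r) β) ≡ false
      blocked with b₀ ℕ.<? L
      ... | yes b₀<L = trans (cong (λ v → (r ≤ᵇ L + a) ∧ not v)
              (trans (cong (λ t → memb t β) (hookTarget hook≡r))
                (trans (memb≡does-∈? _ β) (dec-true (_ ∈? β) (∈-frobeniusBeta-low (reflect-< b₀<L)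
                  (λ b₀∈ → b₀∉ (subst (_∈ B) (reflect-involutive b₀<L) b₀∈)))))))
            (BoolP.∧-zeroʳ (r ≤ᵇ L + a))
      ... | no  b₀≮L = cong (_∧ not (memb (L + a ∸ r) β)) (dec-false (r ℕ.≤? L + a) (λ r≤ →
              ℕP.<-irrefl refl (ℕP.<-≤-trans (subst (L + a <_) hook≡r
                (s≤s (subst (_≤ a + b₀) (ℕP.+-comm a L) (ℕP.+-monoʳ-≤ a (ℕP.≮⇒≥ b₀≮L))))) r≤)))

    armTerm : ∀ {a} → a ∈ A → mnTerm β r rs (L + a) ≡ armSide a
    armTerm {a} a∈ with r ℕ.≤? a
    ... | yes r≤a = armTerm-short a∈ r≤a
    ... | no  r≰a with r ∸ suc a ∈? B
    ...   | yes b₀∈ = armTerm-hook a∈ b₀∈ hook≡r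
      where hook≡r = ℕP.m+[n∸m]≡n {suc a} {r} (ℕP.≰⇒> r≰a)
    ...   | no  b₀∉ = armTerm-blocked hook≡r b₀∉
      where hook≡r = ℕP.m+[n∸m]≡n {suc a} {r} (ℕP.≰⇒> r≰a)

  mn-frobeniusBeta : ∀ rs {L A B} → Frobenius L A B → length rs ≡ length A →
    mn (frobeniusBeta L A B) rs ≡ sgn (sum B) *ℤ pairings A B rs
  mn-frobeniusBeta [] {L} {[]} {[]} F _ = begin
      (if eqList (frobeniusBeta L [] []) (emptyBeta (length (frobeniusBeta L [] []))) then 1ℤ else 0ℤ)
    ≡⟨ cong (λ t → if eqList (frobeniusBeta L [] []) (emptyBeta t) then 1ℤ else 0ℤ) (Frobenius.length-beads F) ⟩
      (if eqList (frobeniusBeta L [] []) (emptyBeta L) then 1ℤ else 0ℤ)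
    ≡⟨ cong (λ t → if eqList t (emptyBeta L) then 1ℤ else 0ℤ) (frobeniusBeta-empty L) ⟩
      (if eqList (emptyBeta L) (emptyBeta L) then 1ℤ else 0ℤ)
    ≡⟨ cong (λ b → if b then 1ℤ else 0ℤ) (eqList-refl (emptyBeta L)) ⟩
      1ℤ
    ∎
    where open ≡-Reasoning
  mn-frobeniusBeta [] {L} {[]} {_ ∷ _} F _ with Frobenius.length-arms≡legs F
  ... | ()
  mn-frobeniusBeta (r ∷ rs) {L} {A} {B} F len = begin
      ∑ (map (L +_) A ++ lowBeads L B) (mnTerm β r rs)
    ≡⟨ ∑-++ (map (L +_) A) (lowBeads L B) (mnTerm β r rs) ⟩
      ∑ (map (L +_) A) (mnTerm β r rs) +ℤ ∑ (lowBeads L B) (mnTerm β r rs)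
    ≡⟨ cong₂ _+ℤ_ (∑-map (L +_) A (mnTerm β r rs)) (∑-zero (lowBeads L B) lowBead-vanishes) ⟩
      ∑ A (λ a → mnTerm β r rs (L + a)) +ℤ 0ℤ
    ≡⟨ ℤP.+-identityʳ _ ⟩
      ∑ A (λ a → mnTerm β r rs (L + a))
    ≡⟨ ∑-cong A armTerm ⟩
      ∑ A armSide
    ≡⟨ ∑-* (sgn (sum B)) _ A ⟩
      sgn (sum B) *ℤ ∑ A (λ a → sgn (countᵇ (a <ᵇ_) A) *ℤ legSum a)
    ≡⟨ cong (sgn (sum B) *ℤ_) pairings-via-legSum ⟨
      sgn (sum B) *ℤ pairings A B (r ∷ rs)
    ∎
    where
    open ≡-Reasoning
    open HookStep F r rs len (mn-frobeniusBeta rs)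

open CharactersViaPairings

module PartitionBeads where

  open import Data.Nat using (_+_; _∸_; _⊔_)
  open import Relation.Nullary using (¬?)
  open import Data.List.Relation.Unary.Linked as Linked using (Linked)
  open import Data.List.Relation.Unary.Linked.Properties using (Linked⇒AllPairs)
  open import Data.List.Membership.Propositional.Properties using (∈-map⁺; ∈-map⁻; ∈-filter⁺; ∈-filter⁻)
  import Data.Bool.Properties as BoolP

  partition-nonIncreasing : ∀ {λ′} → Linked _≥_ λ′ → NonIncreasing λ′
  partition-nonIncreasing = Linked⇒AllPairs (λ y≤x z≤y → ℕP.≤-trans z≤y y≤x)

  length-beta : ∀ λ′ → length (beta λ′) ≡ length λ′
  length-beta []       = refl
  length-beta (x ∷ xs) = cong suc (length-beta xs)

  beta-< : ∀ M λ′ → All (_≤ M) λ′ → All (_< M + length λ′) (beta λ′)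
  beta-< M []       _          = []
  beta-< M (y ∷ ys) (y≤M ∷ ys≤M) =
    ℕP.<-≤-trans (s≤s (ℕP.+-monoˡ-≤ (length ys) y≤M)) (ℕP.≤-reflexive (sym (ℕP.+-suc M (length ys))))
    ∷ All.map (λ b< → ℕP.<-≤-trans b< (ℕP.+-monoʳ-≤ M (ℕP.n≤1+n _))) (beta-< M ys ys≤M)

  beta-decreasing : ∀ {λ′} → NonIncreasing λ′ → Decreasing (beta λ′)
  beta-decreasing {[]}     _            = []
  beta-decreasing {x ∷ xs} (x≥xs ∷ xs↓) = beta-< x xs x≥xs ∷ beta-decreasing xs↓

  -- beadsFrom i λ = #{j : λⱼ ≥ i + j}
  beadsFrom : ℕ → List ℕ → ℕ
  beadsFrom i λ′ = countᵇ ((i + length λ′) ≤ᵇ_) (beta λ′)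

  rankOffset : ℕ → ℕ → ℕ
  rankOffset i zero    = 0
  rankOffset i (suc q) = i + suc q

  rankFrom-vanishes : ∀ j xs → All (_< j) xs → rankFrom j xs ≡ 0
  rankFrom-vanishes j []       _            = refl
  rankFrom-vanishes j (y ∷ ys) (y<j ∷ ys<j) rewrite dec-false (j ℕ.≤? y) (ℕP.<⇒≱ y<j) =
    rankFrom-vanishes (suc j) ys (All.map ℕP.m<n⇒m<1+n ys<j)

  beadsFrom-vanishes : ∀ i xs → All (_≤ i) xs → beadsFrom (suc i) xs ≡ 0
  beadsFrom-vanishes i xs xs≤i = countᵇ-false _ (beta xs) (λ b∈ →
    dec-false (_ ℕ.≤? _) (ℕP.<⇒≱ (ℕP.<-≤-trans (All.lookup (beta-< i xs xs≤i) b∈) (ℕP.n≤1+n _))))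

  beadsFrom-∷ : ∀ i x xs → beadsFrom i (x ∷ xs) ≡ indicator (suc i ≤ᵇ x) + beadsFrom (suc i) xs
  beadsFrom-∷ i x xs = cong₂ _+_ (cong indicator (does-cong (_ ℕ.≤? _) (_ ℕ.≤? _)
      (λ le → ℕP.+-cancelʳ-≤ (length xs) (suc i) x (subst (_≤ x + length xs) (ℕP.+-suc i (length xs)) le))
      (λ le → subst (_≤ x + length xs) (sym (ℕP.+-suc i (length xs))) (ℕP.+-monoˡ-≤ (length xs) le))))
    (countᵇ-cong (beta xs) (λ {y} _ → cong (_≤ᵇ y) (ℕP.+-suc i (length xs))))

  rankOffset-step : ∀ i q → suc i ⊔ rankOffset (suc i) q ≡ rankOffset i (suc q)
  rankOffset-step i zero    = trans (ℕP.⊔-identityʳ (suc i)) (ℕP.+-comm 1 i)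
  rankOffset-step i (suc q) = trans (ℕP.m≤n⇒m⊔n≡n (ℕP.m≤m+n (suc i) (suc q))) (sym (ℕP.+-suc i (suc q)))

  rankFrom≡rankOffset : ∀ i {λ′} → NonIncreasing λ′ → rankFrom (suc i) λ′ ≡ rankOffset i (beadsFrom i λ′)
  rankFrom≡rankOffset i {[]}     _ = refl
  rankFrom≡rankOffset i {x ∷ xs} (x≥xs ∷ xs↓) with suc i ℕ.≤? x
  ... | yes i<x rewrite dec-true (suc i ℕ.≤? x) i<x =
    trans (cong (suc i ⊔_) (rankFrom≡rankOffset (suc i) xs↓))
          (trans (rankOffset-step i (beadsFrom (suc i) xs))
                 (cong (rankOffset i) (sym (trans (beadsFrom-∷ i x xs) (cong (_+ beadsFrom (suc i) xs)
                   (cong indicator (dec-true (suc i ℕ.≤? x) i<x)))))))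
  ... | no  i≮x rewrite dec-false (suc i ℕ.≤? x) i≮x =
    trans (rankFrom-vanishes (suc (suc i)) xs (All.map (λ y≤x → s≤s (ℕP.m≤n⇒m≤1+n (ℕP.≤-trans y≤x x≤i))) x≥xs))
          (cong (rankOffset i) (sym (trans (beadsFrom-∷ i x xs)
            (cong₂ (λ b c → indicator b + c) (dec-false (suc i ℕ.≤? x) i≮x)
                   (beadsFrom-vanishes i xs (All.map (λ y≤x → ℕP.≤-trans y≤x x≤i) x≥xs))))))
    where x≤i = ℕP.≤-pred (ℕP.≰⇒> i≮x)

  rank≡highBeads : ∀ {λ′} → NonIncreasing λ′ → rank λ′ ≡ highBeads (length λ′) (beta λ′)
  rank≡highBeads {λ′} λ↓ = trans (rankFrom≡rankOffset 0 λ↓) (rankOffset-0 (beadsFrom 0 λ′))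
    where
    rankOffset-0 : ∀ q → rankOffset 0 q ≡ q
    rankOffset-0 zero    = refl
    rankOffset-0 (suc q) = refl

  -- the Frobenius coordinates: arms from the beads at positions ≥ ℓ(λ), legs from the gaps below
  arms : List ℕ → List ℕ
  arms λ′ = map (_∸ length λ′) (filter (length λ′ ℕ.≤?_) (beta λ′))

  legs : List ℕ → List ℕ
  legs λ′ = filter (λ y → ¬? (length λ′ ∸ suc y ∈? beta λ′)) (emptyBeta (length λ′))

  rank≡length-arms : ∀ {λ′} → NonIncreasing λ′ → rank λ′ ≡ length (arms λ′)
  rank≡length-arms {λ′} λ↓ = trans (rank≡highBeads λ↓) (sym (trans
    (ListP.length-map _ (filter (length λ′ ℕ.≤?_) (beta λ′))) (length-filter≡countᵇ (length λ′ ℕ.≤?_) (beta λ′))))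

  decreasing-map-∸ : ∀ L {xs} → Decreasing xs → All (L ≤_) xs → Decreasing (map (_∸ L) xs)
  decreasing-map-∸ L {[]}     []           []           = []
  decreasing-map-∸ L {x ∷ xs} (x>xs ∷ xs↓) (_ ∷ L≤xs) =
    AllP.map⁺ (All.zipWith (λ (y<x , L≤y) → ℕP.∸-monoˡ-< y<x L≤y) (x>xs , L≤xs)) ∷ decreasing-map-∸ L xs↓ L≤xs

  module _ {λ′} (λ↓ : NonIncreasing λ′) where

    private
      L = length λ′
      β = beta λ′
      A = arms λ′
      B = legs λ′
      gap? = λ y → ¬? (L ∸ suc y ∈? β)
      β↓ : Decreasing β
      β↓ = beta-decreasing λ↓

    arms-decreasing : Decreasing (arms λ′)
    arms-decreasing = decreasing-map-∸ L (AllPairsP.filter⁺ _ β↓)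
      (All.tabulate (λ x∈ → proj₂ (∈-filter⁻ (L ℕ.≤?_) {xs = β} x∈)))

    beta≡frobeniusBeta : beta λ′ ≡ frobeniusBeta (length λ′) (arms λ′) (legs λ′)
    beta≡frobeniusBeta = decreasing-extensional β↓ (frobeniusBeta-decreasing L B arms-decreasing) forth back
      where
      forth : ∀ {z} → z ∈ β → z ∈ frobeniusBeta L A B
      forth {z} z∈ with L ℕ.≤? z
      ... | yes L≤z = subst (_∈ frobeniusBeta L A B) (ℕP.m+[n∸m]≡n L≤z)
                        (∈-frobeniusBeta-high {L} {A} {B} (∈-map⁺ (_∸ L) (∈-filter⁺ (L ℕ.≤?_) z∈ L≤z)))
      ... | no  L≰z = ∈-frobeniusBeta-low (ℕP.≰⇒> L≰z) (λ gap∈ →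
                        proj₂ (∈-filter⁻ gap? {xs = emptyBeta L} gap∈) (subst (_∈ β) (sym (reflect-involutive (ℕP.≰⇒> L≰z))) z∈))
      back : ∀ {z} → z ∈ frobeniusBeta L A B → z ∈ β
      back {z} z∈ with ∈-frobeniusBeta⁻ {L} {A} {B} z∈
      ... | inj₁ (a , a∈ , refl) with ∈-map⁻ (_∸ L) a∈
      ...   | x , x∈ , refl with ∈-filter⁻ (L ℕ.≤?_) {xs = β} x∈
      ...     | x∈β , L≤x = subst (_∈ β) (sym (ℕP.m+[n∸m]≡n L≤x)) x∈β
      back {z} z∈ | inj₂ (z<L , z∉) with z ∈? β
      ... | yes z∈β = z∈β
      ... | no  z∉β = ⊥-elim (z∉ (∈-filter⁺ gap? (∈-staircase⁺ (reflect-< z<L))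
                        (λ z∈′ → z∉β (subst (_∈ β) (reflect-involutive z<L) z∈′))))

    private
      gap-reflects : ∀ {x} → x < L → not (memb (L ∸ suc x) B) ≡ memb x β
      gap-reflects {x} x<L = begin
          not (memb (L ∸ suc x) B)
        ≡⟨ cong not (trans (memb≡does-∈? _ B) (does-cong (_ ∈? B) (¬? (x ∈? β)) toGap fromGap)) ⟩
          not (not (does (x ∈? β)))
        ≡⟨ BoolP.not-involutive _ ⟩
          does (x ∈? β)
        ≡⟨ memb≡does-∈? x β ⟨
          memb x β
        ∎
        where
        open ≡-Reasoning
        toGap : L ∸ suc x ∈ B → ¬ (x ∈ β)
        toGap y∈ x∈ = proj₂ (∈-filter⁻ gap? {xs = emptyBeta L} y∈) (subst (_∈ β) (sym (reflect-involutive x<L)) x∈)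
        fromGap : ¬ (x ∈ β) → L ∸ suc x ∈ B
        fromGap x∉ = ∈-filter⁺ gap? (∈-staircase⁺ (reflect-< x<L)) (λ x∈ → x∉ (subst (_∈ β) (reflect-involutive x<L) x∈))

      arms+low : length A + length (lowBeads L B) ≡ L
      arms+low = begin
          length A + length (lowBeads L B)             ≡⟨ cong (_+ length (lowBeads L B)) (ListP.length-map (L +_) A) ⟨
          length (map (L +_) A) + length (lowBeads L B) ≡⟨ ListP.length-++ (map (L +_) A) ⟨
          length (frobeniusBeta L A B)                 ≡⟨ cong length beta≡frobeniusBeta ⟨
          length β                                     ≡⟨ length-beta λ′ ⟩
          L                                            ∎
        where open ≡-Reasoning

      low+legs : length (lowBeads L B) + length B ≡ L
      low+legs = begin
          length (lowBeads L B) + length B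
        ≡⟨ cong₂ _+_
             (trans (length-filter≡countᵇ _ (emptyBeta L)) (countᵇ-cong (emptyBeta L) (λ {x} x∈ →
               trans (cong not (sym (memb≡does-∈? (L ∸ suc x) B))) (gap-reflects (∈-staircase⁻ x∈)))))
             (trans (length-filter≡countᵇ gap? (emptyBeta L))
               (trans (countᵇ-cong (emptyBeta L) (λ {x} _ → cong not (sym (memb≡does-∈? (L ∸ suc x) β))))
                 (countᵇ-staircase-reflect (λ y → not (memb y β)) L))) ⟩
          countᵇ (λ x → memb x β) (emptyBeta L) + countᵇ (λ y → not (memb y β)) (emptyBeta L)
        ≡⟨ countᵇ-split (λ _ → true) (λ y → memb y β) (emptyBeta L) ⟩
          countᵇ (λ _ → true) (emptyBeta L)
        ≡⟨ trans (countᵇ-true (λ _ → true) (emptyBeta L) (λ _ → refl)) (length-staircase L) ⟩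
          L
        ∎
        where open ≡-Reasoning

    frobenius-partition : Frobenius (length λ′) (arms λ′) (legs λ′)
    frobenius-partition = record
      { arms-decreasing  = arms-decreasing
      ; legs-decreasing  = AllPairsP.filter⁺ _ (staircase-decreasing L)
      ; legs-<           = All.tabulate (λ y∈ → ∈-staircase⁻ (proj₁ (∈-filter⁻ gap? {xs = emptyBeta L} y∈)))
      ; length-arms≡legs = ℕP.+-cancelʳ-≡ (length (lowBeads L B)) (length A) (length B)
                             (trans arms+low (sym (trans (ℕP.+-comm (length B) _) low+legs)))
      ; length-beads     = trans (cong length (sym beta≡frobeniusBeta)) (length-beta λ′)
      }

open PartitionBeads

module Quotients where

  open import Data.Rational.Unnormalised as ℚᵘ using (ℚᵘ; mkℚᵘ; *≡*)
  import Data.Rational.Unnormalised.Properties as ℚᵘP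
  open import Data.Integer.Tactic.RingSolver using (solve-∀)

  private
    toℚᵘ-/ : ∀ a m → ℚ.toℚᵘ (a ℚ./ suc m) ℚᵘ.≃ mkℚᵘ a m
    toℚᵘ-/ a m = ℚP.toℚᵘ-fromℚᵘ (mkℚᵘ a m)

  /-distrib-+ : ∀ m a b → (a ℤ.+ b) ℚ./ suc m ≡ (a ℚ./ suc m) ℚ.+ (b ℚ./ suc m)
  /-distrib-+ m a b = ℚP.toℚᵘ-injective (begin
      ℚ.toℚᵘ ((a ℤ.+ b) ℚ./ suc m)                       ≈⟨ toℚᵘ-/ (a ℤ.+ b) m ⟩
      mkℚᵘ (a ℤ.+ b) m                                   ≈⟨ *≡* (trans (cong ((a ℤ.+ b) ℤ.*_) (ℤP.pos-* (suc m) (suc m)))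
                                                                   (regroup a b (ℤ.+ suc m))) ⟩
      mkℚᵘ a m ℚᵘ.+ mkℚᵘ b m                             ≈⟨ ℚᵘP.+-cong (toℚᵘ-/ a m) (toℚᵘ-/ b m) ⟨
      ℚ.toℚᵘ (a ℚ./ suc m) ℚᵘ.+ ℚ.toℚᵘ (b ℚ./ suc m)    ≈⟨ ℚP.toℚᵘ-homo-+ (a ℚ./ suc m) (b ℚ./ suc m) ⟨
      ℚ.toℚᵘ ((a ℚ./ suc m) ℚ.+ (b ℚ./ suc m))           ∎)
    where
    open ℚᵘP.≃-Reasoning
    regroup : ∀ a b d → (a ℤ.+ b) ℤ.* (d ℤ.* d) ≡ (a ℤ.* d ℤ.+ b ℤ.* d) ℤ.* d
    regroup = solve-∀

  /-*-integer : ∀ m c a → (c ℚ./ 1) ℚ.* (a ℚ./ suc m) ≡ (c ℤ.* a) ℚ./ suc m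
  /-*-integer m c a = ℚP.toℚᵘ-injective (begin
      ℚ.toℚᵘ ((c ℚ./ 1) ℚ.* (a ℚ./ suc m))               ≈⟨ ℚP.toℚᵘ-homo-* (c ℚ./ 1) (a ℚ./ suc m) ⟩
      ℚ.toℚᵘ (c ℚ./ 1) ℚᵘ.* ℚ.toℚᵘ (a ℚ./ suc m)         ≈⟨ ℚᵘP.*-cong (toℚᵘ-/ c 0) (toℚᵘ-/ a m) ⟩
      mkℚᵘ c 0 ℚᵘ.* mkℚᵘ a m                             ≈⟨ *≡* (cong ((c ℤ.* a) ℤ.*_) (cong ℤ.+_ (sym (ℕP.+-identityʳ (suc m))))) ⟩
      mkℚᵘ (c ℤ.* a) m                                   ≈⟨ toℚᵘ-/ (c ℤ.* a) m ⟨
      ℚ.toℚᵘ ((c ℤ.* a) ℚ./ suc m)                       ∎)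
    where open ℚᵘP.≃-Reasoning

  /-≡0 : ∀ m a → a ℚ./ suc m ≡ 0ℚ → a ≡ 0ℤ
  /-≡0 m a a/m≡0 with ℚᵘP.≃-trans (ℚᵘP.≃-sym (toℚᵘ-/ a m)) (ℚP.toℚᵘ-cong a/m≡0)
  ... | *≡* a*1≡0 = trans (sym (ℤP.*-identityʳ a)) a*1≡0

  *-≡0-cancelʳ : ∀ p q → p ℚ.* q ≡ 0ℚ → q ≢ 0ℚ → p ≡ 0ℚ
  *-≡0-cancelʳ p q pq≡0 q≢0 = begin
      p                                ≡⟨ ℚP.*-identityʳ p ⟨
      p ℚ.* ℚ.1ℚ                       ≡⟨ cong (p ℚ.*_) (ℚP.*-inverseʳ q) ⟨
      p ℚ.* (q ℚ.* ℚ.1/ q)             ≡⟨ ℚP.*-assoc p q _ ⟨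
      (p ℚ.* q) ℚ.* ℚ.1/ q             ≡⟨ cong (ℚ._* ℚ.1/ q) pq≡0 ⟩
      0ℚ ℚ.* ℚ.1/ q                    ≡⟨ ℚP.*-zeroˡ (ℚ.1/ q) ⟩
      0ℚ                               ∎
    where
    open ≡-Reasoning
    instance _ = ℚ.≢-nonZero q≢0

  -- divℕ a 0 = 0, so these identities hold for every denominator
  gated : Bool → ℕ → ℤ → ℚ
  gated g d v = if g then divℕ v d else 0ℚ

  gated-+ : ∀ g d a b → gated g d (a ℤ.+ b) ≡ gated g d a ℚ.+ gated g d b
  gated-+ false d       a b = sym (ℚP.+-identityˡ 0ℚ)
  gated-+ true  zero    a b = sym (ℚP.+-identityˡ 0ℚ)
  gated-+ true  (suc m) a b = /-distrib-+ m a b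

  gated-* : ∀ g d c a → gated g d (c ℤ.* a) ≡ (c ℚ./ 1) ℚ.* gated g d a
  gated-* false d       c a = sym (ℚP.*-zeroʳ (c ℚ./ 1))
  gated-* true  zero    c a = sym (ℚP.*-zeroʳ (c ℚ./ 1))
  gated-* true  (suc m) c a = sym (/-*-integer m c a)

  gated-0 : ∀ g d → gated g d 0ℤ ≡ 0ℚ
  gated-0 false d       = refl
  gated-0 true  zero    = refl
  gated-0 true  (suc m) = ℚP.0/n≡0 (suc m)

  gated-cong : ∀ g d {a b} → (g ≡ true → a ≡ b) → gated g d a ≡ gated g d b
  gated-cong false d _   = refl
  gated-cong true  d a≡b = cong (λ v → divℕ v d) (a≡b refl)

  gated-∑ : ∀ {A : Set} g d (f : A → ℤ) xs → gated g d (∑ xs f) ≡ sumℚ (map (λ x → gated g d (f x)) xs)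
  gated-∑ g d f []       = gated-0 g d
  gated-∑ g d f (x ∷ xs) = trans (gated-+ g d (f x) (∑ xs f)) (cong (gated g d (f x) ℚ.+_) (gated-∑ g d f xs))

open Quotients

module RowsEqualRankPartitions where

  open import Data.Nat using (_+_; _*_; _∸_)
  open import Data.Nat.Tactic.RingSolver using (solve-∀)
  open import Data.List.Relation.Unary.Linked using (Linked; []; [-]; _∷_)
  open import Relation.Nullary using (_×-dec_; ¬?)

  RowsEqualRank : ℕ → ℕ → List ℕ → Set
  RowsEqualRank n k ν = ν ⊢ n × rank ν ≡ k × ℓ ν ≡ k

  gate : ℕ → ℕ → List ℕ → Bool
  gate n k μ = does ((μ ⊢? n) ×-dec (length μ ℕ.≟ k))

  gate-open : ∀ n k μ → gate n k μ ≡ true → μ ⊢ n × length μ ≡ k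
  gate-open n k μ = does⇒ ((μ ⊢? n) ×-dec (length μ ℕ.≟ k))

  sHat-frobenius : ∀ λ′ μ {L A B} → Frobenius L A B → beta λ′ ≡ frobeniusBeta L A B → rank λ′ ≡ length A →
    sHat λ′ μ ≡ gated (gate (sum λ′) (rank λ′) μ) (z μ) (sgn (sum B) ℤ.* pairings A B μ)
  sHat-frobenius λ′ μ F β≡ rank≡ = gated-cong (gate (sum λ′) (rank λ′) μ) (z μ) (λ open-gate →
    trans (cong (λ β → mn β μ) β≡)
          (mn-frobeniusBeta μ F (trans (proj₂ (gate-open (sum λ′) (rank λ′) μ open-gate)) rank≡)))

  withArmsFrom : ℕ → List ℕ → List ℕ
  withArmsFrom t []       = []
  withArmsFrom t (c ∷ cs) = (c + suc t) ∷ withArmsFrom (suc t) cs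

  -- the partition (c₁ + 1, c₂ + 2, …) with arms C and as many rows as its rank
  withArms : List ℕ → List ℕ
  withArms = withArmsFrom 0

  length-withArmsFrom : ∀ t C → length (withArmsFrom t C) ≡ length C
  length-withArmsFrom t []       = refl
  length-withArmsFrom t (c ∷ cs) = cong suc (length-withArmsFrom (suc t) cs)

  beta-withArmsFrom : ∀ t C → beta (withArmsFrom t C) ≡ map ((t + length C) +_) C
  beta-withArmsFrom t []       = refl
  beta-withArmsFrom t (c ∷ cs) = cong₂ _∷_
    (trans (cong (c + suc t +_) (length-withArmsFrom (suc t) cs)) (regroup c t (length cs)))
    (trans (beta-withArmsFrom (suc t) cs) (cong (λ s → map (s +_) cs) (sym (ℕP.+-suc t (length cs)))))
    where
    regroup : ∀ c t l → c + suc t + l ≡ t + suc l + c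
    regroup = solve-∀

  withArmsFrom-positive : ∀ t C → All (1 ≤_) (withArmsFrom t C)
  withArmsFrom-positive t []       = []
  withArmsFrom-positive t (c ∷ cs) = ℕP.≤-trans (s≤s z≤n) (ℕP.m≤n+m (suc t) c) ∷ withArmsFrom-positive (suc t) cs

  withArmsFrom-nonIncreasing : ∀ t {C} → Decreasing C → Linked _≥_ (withArmsFrom t C)
  withArmsFrom-nonIncreasing t {[]}         _                  = []
  withArmsFrom-nonIncreasing t {c ∷ []}     _                  = [-]
  withArmsFrom-nonIncreasing t {c ∷ c′ ∷ cs} ((c′<c ∷ _) ∷ C↓) =
    subst (_≤ c + suc t) (sym (ℕP.+-suc c′ (suc t))) (ℕP.+-monoˡ-≤ (suc t) c′<c) ∷ withArmsFrom-nonIncreasing (suc t) C↓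

  sum-withArmsFrom : ∀ t C → sum (withArmsFrom t C) ≡ sum C + sum (emptyBeta (length C)) + length C + t * length C
  sum-withArmsFrom t []       = sym (ℕP.*-zeroʳ t)
  sum-withArmsFrom t (c ∷ cs) = trans (cong (c + suc t +_) (sum-withArmsFrom (suc t) cs))
    (regroup c t (sum cs) (sum (emptyBeta (length cs))) (length cs))
    where
    regroup : ∀ c t s e l → c + suc t + (s + e + l + suc t * l) ≡ c + s + (l + e) + suc l + t * suc l
    regroup = solve-∀

  sum-withArms : ∀ C → sum (withArms C) ≡ sum C + sum (emptyBeta (length C)) + length C
  sum-withArms C = trans (sum-withArmsFrom 0 C) (ℕP.+-identityʳ _)

  lowBeads-staircase : ∀ k → lowBeads k (emptyBeta k) ≡ []
  lowBeads-staircase k = ListP.filter-none (λ x → ¬? (k ∸ suc x ∈? emptyBeta k)) {emptyBeta k} (All.tabulate (λ x∈ reflected∉ →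
    reflected∉ (∈-staircase⁺ (reflect-< (∈-staircase⁻ x∈)))))

  beta-withArms : ∀ C → beta (withArms C) ≡ frobeniusBeta (length C) C (emptyBeta (length C))
  beta-withArms C = trans (beta-withArmsFrom 0 C) (sym (trans
    (cong (map (length C +_) C ++_) (lowBeads-staircase (length C))) (ListP.++-identityʳ _)))

  frobenius-withArms : ∀ {C} → Decreasing C → Frobenius (length C) C (emptyBeta (length C))
  frobenius-withArms {C} C↓ = record
    { arms-decreasing  = C↓
    ; legs-decreasing  = staircase-decreasing (length C)
    ; legs-<           = staircase-< (length C)
    ; length-arms≡legs = sym (length-staircase (length C))
    ; length-beads     = trans (cong length (sym (beta-withArms C)))
                               (trans (length-beta (withArms C)) (length-withArmsFrom 0 C))
    }

  rank-withArms : ∀ {C} → Decreasing C → rank (withArms C) ≡ length C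
  rank-withArms {C} C↓ = begin
      rank (withArms C)
    ≡⟨ rank≡highBeads (partition-nonIncreasing (withArmsFrom-nonIncreasing 0 C↓)) ⟩
      highBeads (length (withArms C)) (beta (withArms C))
    ≡⟨ cong₂ highBeads (length-withArmsFrom 0 C) (beta-withArms C) ⟩
      highBeads (length C) (frobeniusBeta (length C) C (emptyBeta (length C)))
    ≡⟨ highBeads-frobeniusBeta (length C) C (emptyBeta (length C)) ⟩
      length C
    ∎
    where open ≡-Reasoning

  withArms-rowsEqualRank : ∀ {n k C} → Decreasing C → length C ≡ k → sum (withArms C) ≡ n →
    RowsEqualRank n k (withArms C)
  withArms-rowsEqualRank {C = C} C↓ refl sum≡ =
    (sum≡ , withArmsFrom-positive 0 C , withArmsFrom-nonIncreasing 0 C↓) , rank-withArms C↓ , length-withArmsFrom 0 C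

  sHat-withArms : ∀ {C} μ → Decreasing C → sHat (withArms C) μ ≡
    gated (gate (sum (withArms C)) (length C) μ) (z μ) (sgn (sum (emptyBeta (length C))) ℤ.* pairings C (emptyBeta (length C)) μ)
  sHat-withArms {C} μ C↓ = trans
    (sHat-frobenius (withArms C) μ (frobenius-withArms C↓) (beta-withArms C) (rank-withArms C↓))
    (cong (λ k → gated (gate (sum (withArms C)) k μ) (z μ) (sgn (sum (emptyBeta (length C))) ℤ.* pairings C (emptyBeta (length C)) μ))
          (rank-withArms C↓))

  beta-injective : ∀ xs ys → length xs ≡ length ys → beta xs ≡ beta ys → xs ≡ ys
  beta-injective []       []       _   _  = refl
  beta-injective (x ∷ xs) (y ∷ ys) len β≡ = cong₂ _∷_
    (ℕP.+-cancelʳ-≡ (length xs) x y (trans (ListP.∷-injectiveˡ β≡) (cong (y +_) (sym (ℕP.suc-injective len)))))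
    (beta-injective xs ys (ℕP.suc-injective len) (ListP.∷-injectiveʳ β≡))

  module _ {n k ν} (ν∈ : RowsEqualRank n k ν) where

    private
      ν↓ = partition-nonIncreasing (proj₂ (proj₂ (proj₁ ν∈)))
      F = frobenius-partition ν↓
      rank≡k = proj₁ (proj₂ ν∈)
      ℓ≡k = proj₂ (proj₂ ν∈)

    length-arms : length (arms ν) ≡ k
    length-arms = trans (sym (rank≡length-arms ν↓)) rank≡k

    legs≡staircase : legs ν ≡ emptyBeta (length ν)
    legs≡staircase = decreasing-full⇒staircase (Frobenius.legs-decreasing F) (Frobenius.legs-< F)
      (trans (sym (Frobenius.length-arms≡legs F)) (trans length-arms (sym ℓ≡k)))

    ≡withArms : ν ≡ withArms (arms ν)
    ≡withArms = beta-injective ν (withArms (arms ν)) ν-length (begin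
        beta ν
      ≡⟨ beta≡frobeniusBeta ν↓ ⟩
        frobeniusBeta (length ν) (arms ν) (legs ν)
      ≡⟨ cong₂ (λ L B → frobeniusBeta L (arms ν) B) (trans ℓ≡k (sym length-arms))
               (trans legs≡staircase (cong emptyBeta (trans ℓ≡k (sym length-arms)))) ⟩
        frobeniusBeta (length (arms ν)) (arms ν) (emptyBeta (length (arms ν)))
      ≡⟨ beta-withArms (arms ν) ⟨
        beta (withArms (arms ν))
      ∎)
      where
      open ≡-Reasoning
      ν-length : length ν ≡ length (withArms (arms ν))
      ν-length = trans ℓ≡k (trans (sym length-arms) (sym (length-withArmsFrom 0 (arms ν))))

open RowsEqualRankPartitions

module Spanning where

  open import Data.Nat using (_+_)
  open import Relation.Unary using (Decidable)
  open import Data.List.Membership.Propositional.Properties using (∈-filter⁻)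
  open import Data.Integer.Tactic.RingSolver using (solve-∀)

  ∑-filter : ∀ {A : Set} {P : A → Set} (P? : Decidable P) (f : A → ℤ) xs →
    (∀ {x} → x ∈ xs → ¬ P x → f x ≡ 0ℤ) → ∑ (filter P? xs) f ≡ ∑ xs f
  ∑-filter P? f []       _       = refl
  ∑-filter P? f (x ∷ xs) dropped with P? x
  ... | yes _  = cong (ℤ._+_ (f x)) (∑-filter P? f xs (λ x∈ → dropped (there x∈)))
  ... | no ¬px = trans (∑-filter P? f xs (λ x∈ → dropped (there x∈)))
                       (sym (trans (cong (ℤ._+ ∑ xs f) (dropped (here refl) ¬px)) (ℤP.+-identityˡ (∑ xs f))))

  lincomb-map : ∀ {A : Set} (f : A → ℚ) (g : A → List ℕ) xs μ →
    lincomb (map f xs) (map sHat (map g xs)) μ ≡ sumℚ (map (λ x → f x ℚ.* sHat (g x) μ) xs)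
  lincomb-map f g []       μ = refl
  lincomb-map f g (x ∷ xs) μ = cong (f x ℚ.* sHat (g x) μ ℚ.+_) (lincomb-map f g xs μ)

  module Expansion {n k} (λ′ : List ℕ) (λ⊢n : λ′ ⊢ n) (rank≡k : rank λ′ ≡ k) where

    private
      λ↓ : NonIncreasing λ′
      λ↓ = partition-nonIncreasing (proj₂ (proj₂ λ⊢n))
      F : Frobenius (length λ′) (arms λ′) (legs λ′)
      F = frobenius-partition λ↓
      A B δ : List ℕ
      A = arms λ′
      B = legs λ′
      δ = emptyBeta k
      length-A : length A ≡ k
      length-A = trans (sym (rank≡length-arms λ↓)) rank≡k
      span : Span k (pairings A B)
      span = pairings-span (Frobenius.arms-decreasing F , length-A)
                           (Frobenius.legs-decreasing F , trans (sym (Frobenius.length-arms≡legs F)) length-A)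
      cs kept : List (ℤ × List ℕ)
      cs = proj₁ span
      sized? : (p : ℤ × List ℕ) → Dec (sum (withArms (proj₂ p)) ≡ n)
      sized? (_ , C) = sum (withArms C) ℕ.≟ n
      kept = filter sized? cs
      sB sδ : ℤ
      sB = sgn (sum B)
      sδ = sgn (sum δ)
      coefficient : ℤ × List ℕ → ℚ
      coefficient (q , C) = (sB ℤ.* (sδ ℤ.* q)) ℚ./ 1

    νs : List (List ℕ)
    νs = map (λ (_ , C) → withArms C) kept

    coefficients : List ℚ
    coefficients = map coefficient kept

    kept-ok : All (λ (_ , C) → Arms k C × sum (withArms C) ≡ n) kept
    kept-ok = All.tabulate (λ p∈ → let (p∈cs , sized) = ∈-filter⁻ sized? {xs = cs} p∈ in
      All.lookup (proj₁ (proj₂ span)) p∈cs , sized)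

    νs-ok : All (RowsEqualRank n k) νs
    νs-ok = AllP.map⁺ (All.map (λ ((C↓ , length-C) , sized) → withArms-rowsEqualRank C↓ length-C sized) kept-ok)

    length-≡ : length coefficients ≡ length νs
    length-≡ = trans (ListP.length-map coefficient kept) (sym (ListP.length-map _ kept))

    unsized-vanish : ∀ μ → gate n k μ ≡ true → combination k kept μ ≡ combination k cs μ
    unsized-vanish μ open-gate = ∑-filter sized? _ cs (λ {(q , C)} p∈ unsized →
      trans (cong (q ℤ.*_) (pairings-sizeMismatch μ C δ (λ sum≡ → unsized (begin
          sum (withArms C)                                   ≡⟨ sum-withArms C ⟩
          sum C + sum (emptyBeta (length C)) + length C      ≡⟨ cong (λ l → sum C + sum (emptyBeta l) + l)
                                                                 (trans (proj₂ (All.lookup (proj₁ (proj₂ span)) p∈)) (sym length-μ)) ⟩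
          sum C + sum (emptyBeta (length μ)) + length μ      ≡⟨ cong (λ l → sum C + sum (emptyBeta l) + length μ) length-μ ⟩
          sum C + sum δ + length μ                           ≡⟨ sum≡ ⟨
          sum μ                                              ≡⟨ proj₁ μ⊢n ⟩
          n                                                  ∎))))
      (ℤP.*-zeroʳ q))
      where
      open ≡-Reasoning
      μ⊢n = proj₁ (gate-open n k μ open-gate)
      length-μ = proj₂ (gate-open n k μ open-gate)

    term : ∀ μ {p} → p ∈ kept → coefficient p ℚ.* sHat (withArms (proj₂ p)) μ ≡
      gated (gate n k μ) (z μ) (sB ℤ.* (proj₁ p ℤ.* pairings (proj₂ p) δ μ))
    term μ {q , C} p∈ = begin
        coefficient (q , C) ℚ.* sHat (withArms C) μ
      ≡⟨ cong (coefficient (q , C) ℚ.*_) (trans (sHat-withArms μ C↓)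
           (cong₂ (λ m l → gated (gate m l μ) (z μ) (sgn (sum (emptyBeta l)) ℤ.* pairings C (emptyBeta l) μ)) sized length-C)) ⟩
        coefficient (q , C) ℚ.* gated (gate n k μ) (z μ) (sδ ℤ.* pairings C δ μ)
      ≡⟨ gated-* (gate n k μ) (z μ) (sB ℤ.* (sδ ℤ.* q)) _ ⟨
        gated (gate n k μ) (z μ) ((sB ℤ.* (sδ ℤ.* q)) ℤ.* (sδ ℤ.* pairings C δ μ))
      ≡⟨ cong (gated (gate n k μ) (z μ)) (begin
          (sB ℤ.* (sδ ℤ.* q)) ℤ.* (sδ ℤ.* pairings C δ μ)  ≡⟨ regroup sB sδ q (pairings C δ μ) ⟩
          (sB ℤ.* (q ℤ.* pairings C δ μ)) ℤ.* (sδ ℤ.* sδ)  ≡⟨ cong ((sB ℤ.* (q ℤ.* pairings C δ μ)) ℤ.*_) (sgn-square (sum δ)) ⟩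
          (sB ℤ.* (q ℤ.* pairings C δ μ)) ℤ.* 1ℤ           ≡⟨ ℤP.*-identityʳ (sB ℤ.* (q ℤ.* pairings C δ μ)) ⟩
          sB ℤ.* (q ℤ.* pairings C δ μ)                    ∎) ⟩
        gated (gate n k μ) (z μ) (sB ℤ.* (q ℤ.* pairings C δ μ))
      ∎
      where
      open ≡-Reasoning
      C↓ = proj₁ (proj₁ (All.lookup kept-ok p∈))
      length-C = proj₂ (proj₁ (All.lookup kept-ok p∈))
      sized = proj₂ (All.lookup kept-ok p∈)
      regroup : ∀ b d q g → (b ℤ.* (d ℤ.* q)) ℤ.* (d ℤ.* g) ≡ (b ℤ.* (q ℤ.* g)) ℤ.* (d ℤ.* d)
      regroup = solve-∀

    expansion : ∀ μ → lincomb coefficients (map sHat νs) μ ≡ sHat λ′ μ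
    expansion μ = begin
        lincomb coefficients (map sHat νs) μ
      ≡⟨ lincomb-map coefficient (λ (_ , C) → withArms C) kept μ ⟩
        sumℚ (map (λ p → coefficient p ℚ.* sHat (withArms (proj₂ p)) μ) kept)
      ≡⟨ cong sumℚ (ListP.map-cong-local (All.tabulate (term μ))) ⟩
        sumℚ (map (λ p → gated g (z μ) (sB ℤ.* (proj₁ p ℤ.* pairings (proj₂ p) δ μ))) kept)
      ≡⟨ gated-∑ g (z μ) _ kept ⟨
        gated g (z μ) (∑ kept (λ p → sB ℤ.* (proj₁ p ℤ.* pairings (proj₂ p) δ μ)))
      ≡⟨ cong (gated g (z μ)) (∑-* sB _ kept) ⟩
        gated g (z μ) (sB ℤ.* combination k kept μ)
      ≡⟨ gated-cong g (z μ) (λ open-gate →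
           cong (sB ℤ.*_) (trans (unsized-vanish μ open-gate) (sym (proj₂ (proj₂ span) μ)))) ⟩
        gated g (z μ) (sB ℤ.* pairings A B μ)
      ≡⟨ cong₂ (λ m r → gated (gate m r μ) (z μ) (sB ℤ.* pairings A B μ)) (proj₁ λ⊢n) rank≡k ⟨
        gated (gate (sum λ′) (rank λ′) μ) (z μ) (sB ℤ.* pairings A B μ)
      ≡⟨ sHat-frobenius λ′ μ F (beta≡frobeniusBeta λ↓) (rank≡length-arms λ↓) ⟨
        sHat λ′ μ
      ∎
      where
      open ≡-Reasoning
      g = gate n k μ

  sHat-inSpan : ∀ {n k} λ′ → λ′ ⊢ n → rank λ′ ≡ k → InSpanHat (RowsEqualRank n k) (sHat λ′)
  sHat-inSpan λ′ λ⊢n rank≡k = (νs , coefficients) , νs-ok , length-≡ , expansion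
    where open Expansion λ′ λ⊢n rank≡k

open Spanning

module LinearIndependence where

  open import Data.Nat using (_+_)
  open import Data.Nat.ListAction using (product)
  open import Data.Nat.Tactic.RingSolver using (solve-∀)
  open import Data.List using (zip; applyUpTo)
  open import Data.List.Relation.Unary.Linked using (Linked; []; [-]; _∷_)
  open import Data.List.Relation.Unary.Unique.Propositional using (Unique)
  open import Data.List.Membership.Propositional.Properties using (∈-map⁺)
  import Data.List.Relation.Binary.Lex.Strict as Lex
  open import Data.List.Relation.Binary.Pointwise using (Pointwise-≡⇒≡; ≡⇒Pointwise-≡)
  open import Relation.Binary.Bundles using (StrictTotalOrder)
  open import Relation.Binary.Definitions using (tri<; tri≈; tri>)
  open import Relation.Nullary using (_×-dec_)
  open import Induction.WellFounded using (Acc; acc)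
  open import Data.Nat.Induction using (<-wellFounded)

  private
    module LexOrder = StrictTotalOrder (Lex.<-strictTotalOrder ℕP.<-strictTotalOrder)

  z-positive : ∀ μ → 1 ≤ z μ
  z-positive μ = product-positive _ (sum μ) (λ j →
    ℕP.*-mono-≤ (ℕP.m^n>0 (suc j) (mult (suc j) μ)) (ℕP.1≤n! (mult (suc j) μ)))
    where
    product-positive : ∀ (f : ℕ → ℕ) m → (∀ j → 1 ≤ f j) → 1 ≤ product (applyUpTo f m)
    product-positive f zero    _   = ℕP.≤-refl
    product-positive f (suc m) f>0 = ℕP.*-mono-≤ (f>0 0) (product-positive (λ j → f (suc j)) m (λ j → f>0 (suc j)))

  sgn-nonZero : ∀ m → sgn m ≢ 0ℤ
  sgn-nonZero zero          ()
  sgn-nonZero (suc zero)    ()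
  sgn-nonZero (suc (suc m)) = sgn-nonZero m

  length-diagonalHooks : ∀ A → length (diagonalHooks A) ≡ length A
  length-diagonalHooks []       = refl
  length-diagonalHooks (a ∷ as) = cong suc (length-diagonalHooks as)

  sum-diagonalHooks : ∀ A → sum (diagonalHooks A) ≡ sum A + sum (emptyBeta (length A)) + length A
  sum-diagonalHooks []       = refl
  sum-diagonalHooks (a ∷ as) = trans (cong (suc (a + length as) +_) (sum-diagonalHooks as))
    (regroup a (length as) (sum as) (sum (emptyBeta (length as))))
    where
    regroup : ∀ a l s e → suc (a + l) + (s + e + l) ≡ a + s + (l + e) + suc l
    regroup = solve-∀

  diagonalHooks-partition : ∀ {A} → Decreasing A → diagonalHooks A ⊢ (sum A + sum (emptyBeta (length A)) + length A)
  diagonalHooks-partition {A} A↓ = sum-diagonalHooks A , positive A , nonIncreasing A↓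
    where
    positive : ∀ A → All (1 ≤_) (diagonalHooks A)
    positive []       = []
    positive (a ∷ as) = s≤s z≤n ∷ positive as
    nonIncreasing : ∀ {A} → Decreasing A → Linked _≥_ (diagonalHooks A)
    nonIncreasing {[]}         _               = []
    nonIncreasing {a ∷ []}     _               = [-]
    nonIncreasing {a ∷ a′ ∷ as} ((a′<a ∷ _) ∷ A↓) =
      s≤s (ℕP.≤-trans (ℕP.+-monoˡ-≤ (length as) (ℕP.<⇒≤ a′<a)) (ℕP.+-monoʳ-≤ a (ℕP.n≤1+n _))) ∷ nonIncreasing A↓

  arms-decreasing-rowsEqualRank : ∀ {n k ν} → RowsEqualRank n k ν → Decreasing (arms ν)
  arms-decreasing-rowsEqualRank ν∈ = arms-decreasing (partition-nonIncreasing (proj₂ (proj₂ (proj₁ ν∈))))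

  sHat-rowsEqualRank : ∀ {n k ν} → RowsEqualRank n k ν → ∀ μ → sHat ν μ ≡
    gated (gate n k μ) (z μ) (sgn (sum (emptyBeta k)) ℤ.* pairings (arms ν) (emptyBeta k) μ)
  sHat-rowsEqualRank {n} {k} {ν} ν∈ μ = begin
      sHat ν μ
    ≡⟨ cong (λ ν′ → sHat ν′ μ) (≡withArms ν∈) ⟩
      sHat (withArms A) μ
    ≡⟨ sHat-withArms μ (arms-decreasing-rowsEqualRank ν∈) ⟩
      gated (gate (sum (withArms A)) (length A) μ) (z μ)
        (sgn (sum (emptyBeta (length A))) ℤ.* pairings A (emptyBeta (length A)) μ)
    ≡⟨ cong₂ (λ m l → gated (gate m l μ) (z μ) (sgn (sum (emptyBeta l)) ℤ.* pairings A (emptyBeta l) μ))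
         (trans (cong sum (sym (≡withArms ν∈))) (proj₁ (proj₁ ν∈))) (length-arms ν∈) ⟩
      gated (gate n k μ) (z μ) (sgn (sum (emptyBeta k)) ℤ.* pairings A (emptyBeta k) μ)
    ∎
    where
    open ≡-Reasoning
    A = arms ν

  module _ {n k ν} (ν∈ : RowsEqualRank n k ν) where

    private
      A = arms ν
      A↓ = arms-decreasing-rowsEqualRank ν∈

    gate-diagonalHooks : gate n k (diagonalHooks (arms ν)) ≡ true
    gate-diagonalHooks = dec-true ((diagonalHooks A ⊢? n) ×-dec (length (diagonalHooks A) ℕ.≟ k))
      (subst (diagonalHooks A ⊢_) size (diagonalHooks-partition A↓) , trans (length-diagonalHooks A) (length-arms ν∈))
      where
      size : sum A + sum (emptyBeta (length A)) + length A ≡ n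
      size = begin
        sum A + sum (emptyBeta (length A)) + length A       ≡⟨ sum-withArms A ⟨
        sum (withArms A)                                     ≡⟨ cong sum (≡withArms ν∈) ⟨
        sum ν                                                ≡⟨ proj₁ (proj₁ ν∈) ⟩
        n                                                    ∎
        where open ≡-Reasoning

    sHat-diagonalHooks-self : sHat ν (diagonalHooks (arms ν)) ≢ 0ℚ
    sHat-diagonalHooks-self sHat≡0 = sgn-nonZero (sum (emptyBeta k)) (trans (sym (ℤP.*-identityʳ _))
      (/-≡0 (ℕ.pred (z μ)) _ (trans (cong (λ d → divℕ (sgn (sum (emptyBeta k)) ℤ.* 1ℤ) d) (sym z≡suc)) (begin
        divℕ (sgn (sum (emptyBeta k)) ℤ.* 1ℤ) (z μ)
      ≡⟨ cong (λ t → divℕ (sgn (sum (emptyBeta k)) ℤ.* t) (z μ)) pairings≡1 ⟨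
        divℕ (sgn (sum (emptyBeta k)) ℤ.* pairings A (emptyBeta k) μ) (z μ)
      ≡⟨ cong (λ g → gated g (z μ) (sgn (sum (emptyBeta k)) ℤ.* pairings A (emptyBeta k) μ)) gate-diagonalHooks ⟨
        gated (gate n k μ) (z μ) (sgn (sum (emptyBeta k)) ℤ.* pairings A (emptyBeta k) μ)
      ≡⟨ sHat-rowsEqualRank ν∈ μ ⟨
        sHat ν μ
      ≡⟨ sHat≡0 ⟩
        0ℚ
      ∎))))
      where
      open ≡-Reasoning
      μ = diagonalHooks A
      z≡suc : z μ ≡ suc (ℕ.pred (z μ))
      z≡suc = sym (ℕP.suc-pred (z μ) {{ℕ.>-nonZero (z-positive μ)}})
      pairings≡1 : pairings A (emptyBeta k) μ ≡ 1ℤ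
      pairings≡1 = trans (cong (λ l → pairings A (emptyBeta l) μ) (sym (length-arms ν∈)))
                         (pairings-diagonalHooks-self A A↓)

    sHat-diagonalHooks-lex< : ∀ {ν′} → RowsEqualRank n k ν′ → arms ν′ <ₗₑₓ arms ν →
      sHat ν′ (diagonalHooks (arms ν)) ≡ 0ℚ
    sHat-diagonalHooks-lex< {ν′} ν′∈ A′<A = begin
        sHat ν′ μ
      ≡⟨ sHat-rowsEqualRank ν′∈ μ ⟩
        gated (gate n k μ) (z μ) (sgn (sum (emptyBeta k)) ℤ.* pairings (arms ν′) (emptyBeta k) μ)
      ≡⟨ cong (λ t → gated (gate n k μ) (z μ) (sgn (sum (emptyBeta k)) ℤ.* t)) pairings≡0 ⟩
        gated (gate n k μ) (z μ) (sgn (sum (emptyBeta k)) ℤ.* 0ℤ)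
      ≡⟨ cong (gated (gate n k μ) (z μ)) (ℤP.*-zeroʳ (sgn (sum (emptyBeta k)))) ⟩
        gated (gate n k μ) (z μ) 0ℤ
      ≡⟨ gated-0 (gate n k μ) (z μ) ⟩
        0ℚ
      ∎
      where
      open ≡-Reasoning
      μ = diagonalHooks A
      A′↓ = arms-decreasing-rowsEqualRank ν′∈
      pairings≡0 : pairings (arms ν′) (emptyBeta k) μ ≡ 0ℤ
      pairings≡0 = trans (cong (λ l → pairings (arms ν′) (emptyBeta l) μ) (sym (length-arms ν∈)))
        (pairings-diagonalHooks-lex< (arms ν′) A A′↓ (trans (length-arms ν′∈) (sym (length-arms ν∈))) A′<A)

  ∈-zip⁻ : ∀ {xs : List (List ℕ)} {ys : List ℚ} {x y} → (x , y) ∈ zip xs ys → x ∈ xs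
  ∈-zip⁻ {_ ∷ _} {_ ∷ _} (here refl) = here refl
  ∈-zip⁻ {_ ∷ _} {_ ∷ _} (there p∈)  = there (∈-zip⁻ p∈)

  map-proj₁-zip : ∀ (xs : List (List ℕ)) (ys : List ℚ) → length ys ≡ length xs → map proj₁ (zip xs ys) ≡ xs
  map-proj₁-zip []       []       _   = refl
  map-proj₁-zip (x ∷ xs) (y ∷ ys) len = cong (x ∷_) (map-proj₁-zip xs ys (ℕP.suc-injective len))

  all-zip : ∀ (xs : List (List ℕ)) (ys : List ℚ) → length ys ≡ length xs →
    (∀ {x y} → (x , y) ∈ zip xs ys → y ≡ 0ℚ) → All (_≡ 0ℚ) ys
  all-zip []       []       _   _   = []
  all-zip (x ∷ xs) (y ∷ ys) len y≡0 = y≡0 (here refl) ∷ all-zip xs ys (ℕP.suc-injective len) (λ p∈ → y≡0 (there p∈))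

  lincomb≡sumℚ-zip : ∀ μ νs cs → lincomb cs (map sHat νs) μ ≡ sumℚ (map (λ (ν , c) → c ℚ.* sHat ν μ) (zip νs cs))
  lincomb≡sumℚ-zip μ []       []       = refl
  lincomb≡sumℚ-zip μ []       (_ ∷ _)  = refl
  lincomb≡sumℚ-zip μ (_ ∷ _)  []       = refl
  lincomb≡sumℚ-zip μ (ν ∷ νs) (c ∷ cs) = cong (c ℚ.* sHat ν μ ℚ.+_) (lincomb≡sumℚ-zip μ νs cs)

  sumℚ-single : ∀ (F : List ℕ × ℚ → ℚ) ps {p} → Unique (map proj₁ ps) → p ∈ ps →
    (∀ {p′} → p′ ∈ ps → proj₁ p′ ≢ proj₁ p → F p′ ≡ 0ℚ) → sumℚ (map F ps) ≡ F p
  sumℚ-single F (p ∷ ps) (p∉ps ∷ _) (here refl) others = trans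
    (cong (F p ℚ.+_) (vanish ps (λ p′∈ → others (there p′∈) (λ same → All.lookup p∉ps (∈-map⁺ proj₁ p′∈) (sym same)))))
    (ℚP.+-identityʳ (F p))
    where
    vanish : ∀ qs → (∀ {q} → q ∈ qs → F q ≡ 0ℚ) → sumℚ (map F qs) ≡ 0ℚ
    vanish []       _      = refl
    vanish (q ∷ qs) F≡0 = trans (cong₂ ℚ._+_ (F≡0 (here refl)) (vanish qs (λ q∈ → F≡0 (there q∈)))) (ℚP.+-identityˡ 0ℚ)
  sumℚ-single F (q ∷ ps) (q∉ps ∷ ps-unique) (there p∈) others = trans
    (cong (ℚ._+ sumℚ (map F ps)) (others (here refl) (All.lookup q∉ps (∈-map⁺ proj₁ p∈))))
    (trans (ℚP.+-identityˡ _) (sumℚ-single F ps ps-unique p∈ (λ p′∈ → others (there p′∈))))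

  sHat-linearlyIndependent : ∀ n k → LinIndepHat (RowsEqualRank n k)
  sHat-linearlyIndependent n k νs cs distinct family lengths vanishing =
    all-zip νs cs lengths (λ {ν} p∈ → coefficient-zero p∈ (<-wellFounded (above ν)))
    where
    ps = zip νs cs
    above : List ℕ → ℕ
    above ν = countᵇ (λ ν′ → does (arms ν LexOrder.<? arms ν′)) νs
    coefficient-zero : ∀ {ν c} → (ν , c) ∈ ps → Acc _<_ (above ν) → c ≡ 0ℚ
    coefficient-zero {ν} {c} p∈ (acc rec) = *-≡0-cancelʳ c (sHat ν μ) only-ν (sHat-diagonalHooks-self ν∈)
      where
      ν∈ = All.lookup family (∈-zip⁻ p∈)
      μ = diagonalHooks (arms ν)
      others : ∀ {p′} → p′ ∈ ps → proj₁ p′ ≢ ν → proj₂ p′ ℚ.* sHat (proj₁ p′) μ ≡ 0ℚ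
      others {ν′ , c′} p′∈ ν′≢ν with LexOrder.compare (arms ν′) (arms ν)
      ... | tri< A′<A _ _ = trans (cong (c′ ℚ.*_) (sHat-diagonalHooks-lex< ν∈ ν′∈ A′<A)) (ℚP.*-zeroʳ c′)
        where ν′∈ = All.lookup family (∈-zip⁻ p′∈)
      ... | tri≈ _ A′≈A _ = ⊥-elim (ν′≢ν (trans (≡withArms ν′∈)
              (trans (cong withArms (Pointwise-≡⇒≡ A′≈A)) (sym (≡withArms ν∈)))))
        where ν′∈ = All.lookup family (∈-zip⁻ p′∈)
      ... | tri> _ _ A<A′ = trans (cong (ℚ._* sHat ν′ μ) (coefficient-zero p′∈ (rec fewerAbove))) (ℚP.*-zeroˡ (sHat ν′ μ))
        where
        fewerAbove : above ν′ < above ν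
        fewerAbove = countᵇ-< _ _ νs
          (λ _ A′<A″ → dec-true (arms ν LexOrder.<? _) (LexOrder.trans A<A′ (does⇒ (arms ν′ LexOrder.<? _) A′<A″)))
          (∈-zip⁻ p′∈) (dec-true (arms ν LexOrder.<? arms ν′) A<A′)
          (dec-false (arms ν′ LexOrder.<? arms ν′) (LexOrder.irrefl (≡⇒Pointwise-≡ refl)))
      only-ν : c ℚ.* sHat ν μ ≡ 0ℚ
      only-ν = trans (sym (sumℚ-single (λ (ν′ , c′) → c′ ℚ.* sHat ν′ μ) ps
                            (subst Unique (sym (map-proj₁-zip νs cs lengths)) distinct) p∈ others))
                     (trans (sym (lincomb≡sumℚ-zip μ νs cs)) (vanishing μ))

open LinearIndependence

theorem4p3 : (n k : ℕ) → 1 ≤ n → 1 ≤ k →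
    LinIndepHat (λ ν → ν ⊢ n × rank ν ≡ k × ℓ ν ≡ k)
    × ((λ′ : List ℕ) → λ′ ⊢ n → rank λ′ ≡ k →
         InSpanHat (λ ν → ν ⊢ n × rank ν ≡ k × ℓ ν ≡ k) (sHat λ′))
theorem4p3 n k _ _ = sHat-linearlyIndependent n k , sHat-inSpan
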